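{- Let $n\ge 3$ and let $D_n$ be the dihedral group. The saturated subsets of $D_n$ are: (a) if $n$ is odd: $\{e\}$ and $\{f,fr,\ldots,fr^{n-1}\}$; (b) if $n$ is even: the sets $\{e,r^k\}$ where $\frac{n}{\gcd(n,k)}$ is even; the sets $\{r^{2k},r^{2l}\}$ where $\frac{n}{\gcd(n,2k)}$ and $\frac{n}{\gcd(n,2l)}$ are even and $2$ appears with equal multiplicity in $2k$ and $2l$; and the three $n$-element sets $A\cup B$, $A\cup C$, $B\cup C$, where $A=\{r,r^3,\ldots,r^{n-1}\}$, $B=\{f,fr^2,\ldots,fr^{n-2}\}$, $C=\{fr,fr^3,\ldots,fr^{n-1}\}$.
   Context: For $n\ge3$, $D_n$ is the group of order $2n$ generated by $r,f$ with relations $r^n=f^2=e$ and $fr=r^{ -1}f$; every element is uniquely $r^a$ or $fr^a$ with $a\in\mathbb{Z}/n\mathbb{Z}$. For a group $S$, a subset $U\subseteq S$ is avoidable if there is a partition $\{A',B'\}$ of $S$ such that no element of $U$ equals $xy$ with $x\neq y$ both in $A'$ or both in $B'$ (in either order). A subset is saturated if it is maximal with respect to inclusion among the avoidable subsets. -}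

module Defs where

open import Data.Nat using (ℕ; zero; suc; _+_; _*_; _∸_; _^_; _≤_)
open import Data.Nat.DivMod using (_%_; _/_; m%n<n)
open import Data.Nat.GCD using (gcd)
open import Data.Nat.Divisibility using (_∣_)
open import Data.Fin using (Fin; toℕ; fromℕ<)
open import Data.Bool using (Bool; true; false; _∨_; not)
open import Data.Product using (_×_; ∃)
open import Data.Sum using (_⊎_)
open import Relation.Binary.PropositionalEquality using (_≡_; _≢_)
open import Relation.Nullary using (¬_)

-- Arithmetic in ℤ/nℤ, represented by Fin n.
_⊕_ : {n : ℕ} → Fin n → Fin n → Fin n
_⊕_ {suc m} a b = fromℕ< (m%n<n (toℕ a + toℕ b) (suc m))

_⊖_ : {n : ℕ} → Fin n → Fin n → Fin n
_⊖_ {suc m} a b = fromℕ< (m%n<n (toℕ a + (suc m ∸ toℕ b)) (suc m))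

-- Elements of the dihedral group D_n: rot a = r^a, ref a = f r^a.
data Dih (n : ℕ) : Set where
  rot : Fin n → Dih n
  ref : Fin n → Dih n

-- Group law, from r^n = f^2 = e and f r = r^{-1} f.
_·_ : {n : ℕ} → Dih n → Dih n → Dih n
rot a · rot b = rot (a ⊕ b)
rot a · ref b = ref (b ⊖ a)   -- r^a f r^b = f r^(b-a)
ref a · rot b = ref (a ⊕ b)
ref a · ref b = rot (b ⊖ a)   -- f r^a f r^b = r^(b-a)

Subset : ℕ → Set
Subset n = Dih n → Bool

_⊆_ : {n : ℕ} → Subset n → Subset n → Set
U ⊆ V = ∀ x → U x ≡ true → V x ≡ true

_≐_ : {n : ℕ} → Subset n → Subset n → Set
U ≐ V = ∀ x → U x ≡ V x

-- U is avoidable: there is a partition {A', B'} of D_n (A' = colour true,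
-- B' = colour false, both parts nonempty) such that no element of U is a
-- product x·y with x ≠ y in the same part.
Avoidable : {n : ℕ} → Subset n → Set
Avoidable {n} U =
  ∃ λ (c : Dih n → Bool) →
    (∃ λ x → c x ≡ true) × (∃ λ y → c y ≡ false) ×
    (∀ x y → x ≢ y → c x ≡ c y → U (x · y) ≡ false)

Saturated : {n : ℕ} → Subset n → Set
Saturated {n} U = Avoidable U × (∀ (V : Subset n) → Avoidable V → U ⊆ V → V ⊆ U)

-- a div d = a / d (d ≠ 0); only used with d = gcd n k, which is nonzero for n ≥ 3.
_div_ : ℕ → ℕ → ℕ
a div zero = zero
a div suc d = a / suc d

SameTwoMult : ℕ → ℕ → Set
SameTwoMult a b = ∀ i → ((2 ^ i ∣ a → 2 ^ i ∣ b) × (2 ^ i ∣ b → 2 ^ i ∣ a))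

dbl : {n : ℕ} → Fin n → Fin n
dbl k = k ⊕ k

isZero : ℕ → Bool
isZero zero = true
isZero (suc _) = false

isEven : ℕ → Bool
isEven zero = true
isEven (suc zero) = false
isEven (suc (suc m)) = isEven m

eqFin : {n : ℕ} → Fin n → Fin n → Bool
eqFin a b = eqℕ (toℕ a) (toℕ b)
  where
  eqℕ : ℕ → ℕ → Bool
  eqℕ zero zero = true
  eqℕ zero (suc _) = false
  eqℕ (suc _) zero = false
  eqℕ (suc m) (suc k) = eqℕ m k

setE : {n : ℕ} → Subset n
setE (rot a) = isZero (toℕ a)
setE (ref _) = false

setF : {n : ℕ} → Subset n
setF (rot _) = false
setF (ref _) = true

setEk : {n : ℕ} → Fin n → Subset n
setEk k (rot a) = isZero (toℕ a) ∨ eqFin a k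
setEk k (ref _) = false

setPair : {n : ℕ} → Fin n → Fin n → Subset n
setPair i j (rot a) = eqFin a i ∨ eqFin a j
setPair i j (ref _) = false

setA : {n : ℕ} → Subset n
setA (rot a) = not (isEven (toℕ a))
setA (ref _) = false

setB : {n : ℕ} → Subset n
setB (rot _) = false
setB (ref a) = isEven (toℕ a)

setC : {n : ℕ} → Subset n
setC (rot _) = false
setC (ref a) = not (isEven (toℕ a))

_∪_ : {n : ℕ} → Subset n → Subset n → Subset n
(U ∪ V) x = U x ∨ V x

ListedOdd : {n : ℕ} → Subset n → Set
ListedOdd U = (U ≐ setE) ⊎ (U ≐ setF)

ListedEven : (n : ℕ) → Subset n → Set
ListedEven n U =
  (∃ λ (k : Fin n) → 2 ∣ (n div gcd n (toℕ k)) × (U ≐ setEk k))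
  ⊎ (∃ λ (k : Fin n) → ∃ λ (l : Fin n) →
        2 ∣ (n div gcd n (2 * toℕ k)) × 2 ∣ (n div gcd n (2 * toℕ l))
        × SameTwoMult (2 * toℕ k) (2 * toℕ l)
        × dbl k ≢ dbl l
        × (U ≐ setPair (dbl k) (dbl l)))
  ⊎ (U ≐ (setA ∪ setB)) ⊎ (U ≐ (setA ∪ setC)) ⊎ (U ≐ (setB ∪ setC))

-- Write a colouring c of D_n as ρ(a) = c(r^a) and φ(a) = c(f r^a). If c avoids U, then r^t ∈ U
-- forces ρ(a) ≠ ρ(t - a) and, for t ≠ 0, φ(a) ≠ φ(a + t): φ alternates along t, so n is even, t has
-- even order and all such t share their 2-adic valuation. A reflection f r^s ∈ U forces
-- ρ(a) ≠ φ(s + a) and ρ(a) ≠ φ(s - a), so ρ is even and alternates along every nonzero rotation in U;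
-- hence those rotations are odd and, if U has one, all reflections in U have one parity. Three rotations
-- t₁, t₂, t₃ ∈ U with t₁ - t₂ + t₃ = 2h close an odd cycle h, t₁ - h, t₂ - t₁ + h of ρ. So every
-- avoidable set lies in a listed set. Conversely each listed set is avoided by an explicit colouring:
-- parity for A ∪ B and A ∪ C, rotations against reflections for B ∪ C and for the reflections, and
-- for {e}, {e, r^k}, {r^2k, r^2l} a binary digit of a on the reflections (at the 2-adic valuation of
-- the rotations) together with a colouring of ℤ/n separating the pairs {a, -a} and {a, d - a}.
-- Finally the listed sets are pairwise incomparable, so they are exactly the maximal avoidable sets.

module Submission where

open import Defs
open import Data.Nat as ℕ using (ℕ; zero; suc; NonZero; z≤n; s≤s; _≤_; _∸_; _^_; _<?_; _≤?_)
import Data.Nat.Properties as ℕₚ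
import Algebra.Properties.CommutativeSemigroup ℕₚ.*-commutativeSemigroup as ℕ*
import Data.Nat.Tactic.RingSolver as ℕRing
open import Data.Nat.DivMod using (_%_; _/_; m%n<n; m≡m%n+[m/n]*n; m/n*n≡m; m*[n/m]≡n; m/n≤m; m*n/n≡m; n/n≡1)
open import Data.Nat.Divisibility
  using (_∣_; divides; _∣?_; quotient; ∣-refl; ∣-trans; 1∣_; _∣0; ∣1⇒≡1; ∣⇒≤; *-pres-∣; *-monoˡ-∣; m∣m*n;
         ∣n⇒∣m*n; m%n≡0⇒n∣m)
open import Data.Nat.GCD
  using (gcd; gcd[m,n]∣m; gcd[m,n]∣n; gcd[m,n]≢0; gcd-greatest; gcd-GCD; module GCD; module Bézout)
open import Data.Integer as ℤ using (ℤ; +_; -[1+_]; _+_; _*_; _-_; -_)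
import Data.Integer.Properties as ℤₚ
open import Data.Integer.DivMod using (_%ℕ_; _/ℕ_; a≡a%ℕn+[a/ℕn]*n; n%ℕd<d)
open import Data.Integer.Tactic.RingSolver using (solve-∀)
open import Data.Fin as Fin using (Fin; toℕ; fromℕ<)
open import Data.Fin.Properties using (toℕ-fromℕ<; toℕ<n; toℕ-injective; _≟_; any?)
open import Data.Bool using (Bool; true; false; not; _∧_; _∨_; if_then_else_)
import Data.Bool as Bool
open import Data.Bool.Properties using (¬-not; not-¬; not-involutive; not-injective; ∧-zeroʳ; ∨-zeroʳ; ∨-inverseʳ)
open import Data.Product using (∃; _×_; _,_; proj₁; proj₂)
open import Data.Sum using (_⊎_; inj₁; inj₂)
open import Data.Empty using (⊥; ⊥-elim)
open import Function using (_∘_; id; const; case_of_)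
open import Function.Bundles using (_⇔_; mk⇔)
open import Function.Construct.Composition using (_⇔-∘_)
open import Level using (0ℓ)
open import Relation.Binary.Bundles using (Setoid)
import Relation.Binary.Reasoning.Setoid as SetoidReasoning
open import Relation.Binary.Definitions using (tri<; tri≈; tri>)
open import Relation.Binary.PropositionalEquality
open import Relation.Nullary using (¬_; Dec; yes; no; does)
open import Relation.Nullary.Decidable using (dec-true; dec-false; _×-dec_; ¬?)

-- Congruences modulo N

infix 4 _≡_mod_

record _≡_mod_ (a b : ℤ) (N : ℕ) : Set where
  constructor mkMod
  field
    quot : ℤ
    equation : a ≡ b + quot * + N

pos-+* : ∀ b k N → + (b ℕ.+ k ℕ.* N) ≡ + b + + k * + N
pos-+* b k N = trans (ℤₚ.pos-+ b (k ℕ.* N)) (cong (_+_ (+ b)) (ℤₚ.pos-* k N))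

module _ {N : ℕ} where

  mod-reflexive : ∀ {a b} → a ≡ b → a ≡ b mod N
  mod-reflexive {a} refl = mkMod (+ 0) (sym (ℤₚ.+-identityʳ a))

  mod-refl : ∀ {a} → a ≡ a mod N
  mod-refl = mod-reflexive refl

  mod-sym : ∀ {a b} → a ≡ b mod N → b ≡ a mod N
  mod-sym {b = b} (mkMod q e) = mkMod (- q) (trans (ring b q (+ N)) (cong (_+ - q * + N) (sym e)))
    where ring : ∀ b q n → b ≡ b + q * n + - q * n
          ring = solve-∀

  mod-trans : ∀ {a b c} → a ≡ b mod N → b ≡ c mod N → a ≡ c mod N
  mod-trans {c = c} (mkMod q refl) (mkMod r refl) = mkMod (r + q) (ring c r q (+ N))
    where ring : ∀ c r q n → c + r * n + q * n ≡ c + (r + q) * n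
          ring = solve-∀

  +-cong-mod : ∀ {a b c d} → a ≡ b mod N → c ≡ d mod N → a + c ≡ b + d mod N
  +-cong-mod {b = b} {d = d} (mkMod q refl) (mkMod r refl) = mkMod (q + r) (ring b d q r (+ N))
    where ring : ∀ b d q r n → b + q * n + (d + r * n) ≡ b + d + (q + r) * n
          ring = solve-∀

  neg-cong-mod : ∀ {a b} → a ≡ b mod N → - a ≡ - b mod N
  neg-cong-mod {b = b} (mkMod q refl) = mkMod (- q) (ring b q (+ N))
    where ring : ∀ b q n → - (b + q * n) ≡ - b + - q * n
          ring = solve-∀

  minus-cong-mod : ∀ {a b c d} → a ≡ b mod N → c ≡ d mod N → a - c ≡ b - d mod N
  minus-cong-mod p q = +-cong-mod p (neg-cong-mod q)

  *-congˡ-mod : ∀ {a b} c → a ≡ b mod N → c * a ≡ c * b mod N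
  *-congˡ-mod {b = b} c (mkMod q refl) = mkMod (c * q) (ring b q c (+ N))
    where ring : ∀ b q c n → c * (b + q * n) ≡ c * b + c * q * n
          ring = solve-∀

  %-mod : ∀ x .{{_ : NonZero N}} → + (x % N) ≡ + x mod N
  %-mod x = mod-sym (mkMod (+ (x / N)) (begin
    + x                          ≡⟨ cong +_ (m≡m%n+[m/n]*n x N) ⟩
    + (x % N ℕ.+ x / N ℕ.* N)    ≡⟨ ℤₚ.pos-+ (x % N) _ ⟩
    + (x % N) + + (x / N ℕ.* N)  ≡⟨ cong (_+_ (+ (x % N))) (ℤₚ.pos-* (x / N) N) ⟩
    + (x % N) + + (x / N) * + N  ∎))
    where open ≡-Reasoning

  ∣⇒≡0-mod : ∀ {x} → N ∣ x → + x ≡ + 0 mod N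
  ∣⇒≡0-mod (divides q refl) = mkMod (+ q) (trans (ℤₚ.pos-* q N) (sym (ℤₚ.+-identityˡ _)))

  ≡-mod⇒≡+* : ∀ {a b} → + a ≡ + b mod N →
              (∃ λ k → a ≡ b ℕ.+ k ℕ.* N) ⊎ (∃ λ k → b ≡ a ℕ.+ k ℕ.* N)
  ≡-mod⇒≡+* {b = b} (mkMod (+ k) e) = inj₁ (k , ℤₚ.+-injective (trans e (sym (pos-+* b k N))))
  ≡-mod⇒≡+* {a} p@(mkMod -[1+ k ] _) =
    inj₂ (suc k , ℤₚ.+-injective (trans (_≡_mod_.equation (mod-sym p)) (sym (pos-+* a (suc k) N))))

  ≡-mod⇒≡ : ∀ {a b} → a ℕ.< N → b ℕ.< N → + a ≡ + b mod N → a ≡ b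
  ≡-mod⇒≡ {a} {b} a<N b<N p with ≡-mod⇒≡+* p
  ... | inj₁ (zero , e)  = trans e (ℕₚ.+-identityʳ b)
  ... | inj₁ (suc k , e) = ⊥-elim (ℕₚ.<⇒≱ a<N (subst (N ℕ.≤_) (sym e) (ℕₚ.≤-trans (ℕₚ.m≤m+n N _) (ℕₚ.m≤n+m _ b))))
  ... | inj₂ (zero , e)  = sym (trans e (ℕₚ.+-identityʳ a))
  ... | inj₂ (suc k , e) = ⊥-elim (ℕₚ.<⇒≱ b<N (subst (N ℕ.≤_) (sym e) (ℕₚ.≤-trans (ℕₚ.m≤m+n N _) (ℕₚ.m≤n+m _ a))))

  ≡0-mod⇒∣ : ∀ {x} → + x ≡ + 0 mod N → N ∣ x
  ≡0-mod⇒∣ {x} p with ≡-mod⇒≡+* p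
  ... | inj₁ (k , e) = divides k e
  ... | inj₂ (zero , e) = divides 0 (sym (trans e (ℕₚ.+-identityʳ x)))
  ... | inj₂ (suc k , e) = divides 0 (ℕₚ.m+n≡0⇒m≡0 x (sym e))

  residue-sum : ∀ {a b s} → a ℕ.< N → b ℕ.< N → s ℕ.< N → + (a ℕ.+ b) ≡ + s mod N →
                a ℕ.+ b ≡ s ⊎ a ℕ.+ b ≡ s ℕ.+ N
  residue-sum {a} {b} {s} a<N b<N s<N p with ≡-mod⇒≡+* p
  ... | inj₁ (zero , e) = inj₁ (trans e (ℕₚ.+-identityʳ s))
  ... | inj₁ (suc zero , e) = inj₂ (trans e (cong (s ℕ.+_) (ℕₚ.+-identityʳ N)))
  ... | inj₁ (suc (suc k) , e) =
    ⊥-elim (ℕₚ.<⇒≱ (ℕₚ.+-mono-< a<N b<N) (subst (N ℕ.+ N ℕ.≤_) (sym e)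
      (ℕₚ.≤-trans (ℕₚ.+-monoʳ-≤ N (ℕₚ.m≤m+n N (k ℕ.* N))) (ℕₚ.m≤n+m _ s))))
  ... | inj₂ (zero , e) = inj₁ (sym (trans e (ℕₚ.+-identityʳ _)))
  ... | inj₂ (suc k , e) =
    ⊥-elim (ℕₚ.<⇒≱ s<N (subst (N ℕ.≤_) (sym e) (ℕₚ.≤-trans (ℕₚ.m≤m+n N _) (ℕₚ.m≤n+m _ (a ℕ.+ b)))))

mod-≡-modulus : ∀ {M N a b} → M ≡ N → a ≡ b mod M → a ≡ b mod N
mod-≡-modulus refl p = p

mod-setoid : ℕ → Setoid 0ℓ 0ℓ
mod-setoid N = record
  { Carrier = ℤ
  ; _≈_ = _≡_mod N
  ; isEquivalence = record { refl = mod-refl ; sym = mod-sym ; trans = mod-trans }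
  }

module ≡-mod-Reasoning (N : ℕ) = SetoidReasoning (mod-setoid N)

mod-∣-weaken : ∀ {M N a b} → M ∣ N → a ≡ b mod N → a ≡ b mod M
mod-∣-weaken {M} {b = b} (divides c refl) (mkMod q refl) =
  mkMod (q * + c) (cong (_+_ b) (trans (cong (q *_) (ℤₚ.pos-* c M)) (sym (ℤₚ.*-assoc q (+ c) (+ M)))))

*-cancelʳ-mod : ∀ {M a b} c .{{_ : NonZero c}} → a * + c ≡ b * + c mod (M ℕ.* c) → a ≡ b mod M
*-cancelʳ-mod {M} {a} {b} c (mkMod q e) = mkMod q (ℤₚ.*-cancelʳ-≡ a (b + q * + M) (+ c) (begin
  a * + c                  ≡⟨ e ⟩
  b * + c + q * + (M ℕ.* c) ≡⟨ cong (λ x → b * + c + q * x) (ℤₚ.pos-* M c) ⟩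
  b * + c + q * (+ M * + c) ≡⟨ ring b q (+ M) (+ c) ⟩
  (b + q * + M) * + c      ∎))
  where
  open ≡-Reasoning
  ring : ∀ b q m c → b * c + q * (m * c) ≡ (b + q * m) * c
  ring = solve-∀

mod⇒%≡ : ∀ {N x y} .{{_ : NonZero N}} → + x ≡ + y mod N → x % N ≡ y % N
mod⇒%≡ {N} {x} {y} p = ≡-mod⇒≡ (m%n<n x N) (m%n<n y N) (mod-trans (%-mod x) (mod-trans p (mod-sym (%-mod y))))

pos-[m/n]*n : ∀ m n .{{_ : NonZero n}} → + (m / n) * + n ≡ + m - + (m % n)
pos-[m/n]*n m n = begin
  + (m / n) * + n                           ≡⟨ ring (+ (m % n)) (+ (m / n) * + n) ⟩
  + (m % n) + + (m / n) * + n - + (m % n)   ≡⟨ cong (_- + (m % n)) (sym (pos-+* (m % n) (m / n) n)) ⟩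
  + (m % n ℕ.+ m / n ℕ.* n) - + (m % n)     ≡⟨ cong (λ z → + z - + (m % n)) (sym (m≡m%n+[m/n]*n m n)) ⟩
  + m - + (m % n)                           ∎
  where
  open ≡-Reasoning
  ring : ∀ r q → q ≡ r + q - r
  ring = solve-∀

%ℕ-mod : ∀ a N .{{_ : NonZero N}} → + (a %ℕ N) ≡ a mod N
%ℕ-mod a N = mod-sym (mkMod (a /ℕ N) (a≡a%ℕn+[a/ℕn]*n a N))

*-scaleˡ-mod : ∀ {M a b} c → a ≡ b mod M → + c * a ≡ + c * b mod (c ℕ.* M)
*-scaleˡ-mod {M} {b = b} c (mkMod q refl) =
  mkMod q (trans (ring (+ c) b q (+ M)) (cong (λ z → + c * b + q * z) (sym (ℤₚ.pos-* c M))))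
  where ring : ∀ c b q m → c * (b + q * m) ≡ c * b + q * (c * m)
        ring = solve-∀

*-cancelˡ-mod : ∀ {M a b} c .{{_ : NonZero c}} → + c * a ≡ + c * b mod (c ℕ.* M) → a ≡ b mod M
*-cancelˡ-mod {M} {a} {b} c (mkMod q e) = mkMod q (ℤₚ.*-cancelˡ-≡ (+ c) a (b + q * + M) (begin
  + c * a                    ≡⟨ e ⟩
  + c * b + q * + (c ℕ.* M)  ≡⟨ cong (λ x → + c * b + q * x) (ℤₚ.pos-* c M) ⟩
  + c * b + q * (+ c * + M)  ≡⟨ ring (+ c) b q (+ M) ⟩
  + c * (b + q * + M)        ∎))
  where
  open ≡-Reasoning
  ring : ∀ c b q m → c * b + q * (c * m) ≡ c * (b + q * m)
  ring = solve-∀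

-- The group ℤ/N on Fin N

toℤ : ∀ {n} → Fin n → ℤ
toℤ a = + toℕ a

module _ {m : ℕ} where

  private
    N = suc m

  ⊕-mod : (a b : Fin N) → toℤ (a ⊕ b) ≡ toℤ a + toℤ b mod N
  ⊕-mod a b rewrite toℕ-fromℕ< (m%n<n (toℕ a ℕ.+ toℕ b) N) =
    mod-trans (%-mod (toℕ a ℕ.+ toℕ b)) (mod-reflexive (ℤₚ.pos-+ (toℕ a) (toℕ b)))

  ⊖-mod : (a b : Fin N) → toℤ (a ⊖ b) ≡ toℤ a - toℤ b mod N
  ⊖-mod a b rewrite toℕ-fromℕ< (m%n<n (toℕ a ℕ.+ (N ∸ toℕ b)) N) =
    mod-trans (%-mod (toℕ a ℕ.+ (N ∸ toℕ b))) (mkMod (+ 1) (begin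
      + (toℕ a ℕ.+ (N ∸ toℕ b))   ≡⟨ ℤₚ.pos-+ (toℕ a) (N ∸ toℕ b) ⟩
      toℤ a + + (N ∸ toℕ b)       ≡⟨ cong (_+_ (toℤ a)) (sym (ℤₚ.⊖-≥ (ℕₚ.<⇒≤ (toℕ<n b)))) ⟩
      toℤ a + (N ℤ.⊖ toℕ b)       ≡⟨ cong (_+_ (toℤ a)) (sym (ℤₚ.[+m]-[+n]≡m⊖n N (toℕ b))) ⟩
      toℤ a + (+ N - toℤ b)       ≡⟨ ring (toℤ a) (toℤ b) (+ N) ⟩
      toℤ a - toℤ b + + 1 * + N   ∎))
    where
    open ≡-Reasoning
    ring : ∀ a b n → a + (n - b) ≡ a - b + + 1 * n
    ring = solve-∀

  toℤ-injective-mod : {a b : Fin N} → toℤ a ≡ toℤ b mod N → a ≡ b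
  toℤ-injective-mod {a} {b} p = toℕ-injective (≡-mod⇒≡ (toℕ<n a) (toℕ<n b) p)

  neg : Fin N → Fin N
  neg a = Fin.zero ⊖ a

  infixl 6 _⊞_ _⊟_
  infix 8 `_

  -- Terms of the additive group ℤ/N; an identity between them holds in ℤ/N as soon as
  -- the corresponding identity between integer representatives holds in ℤ.
  data Term : Set where
    `_ : Fin N → Term
    𝟘 : Term
    _⊞_ _⊟_ : Term → Term → Term

  ⟦_⟧ : Term → Fin N
  ⟦ ` a ⟧ = a
  ⟦ 𝟘 ⟧ = Fin.zero
  ⟦ x ⊞ y ⟧ = ⟦ x ⟧ ⊕ ⟦ y ⟧
  ⟦ x ⊟ y ⟧ = ⟦ x ⟧ ⊖ ⟦ y ⟧

  ⟦_⟧ℤ : Term → ℤ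
  ⟦ ` a ⟧ℤ = toℤ a
  ⟦ 𝟘 ⟧ℤ = + 0
  ⟦ x ⊞ y ⟧ℤ = ⟦ x ⟧ℤ + ⟦ y ⟧ℤ
  ⟦ x ⊟ y ⟧ℤ = ⟦ x ⟧ℤ - ⟦ y ⟧ℤ

  ⟦⟧-mod : (x : Term) → toℤ ⟦ x ⟧ ≡ ⟦ x ⟧ℤ mod N
  ⟦⟧-mod (` a) = mod-refl
  ⟦⟧-mod 𝟘 = mod-refl
  ⟦⟧-mod (x ⊞ y) = mod-trans (⊕-mod ⟦ x ⟧ ⟦ y ⟧) (+-cong-mod (⟦⟧-mod x) (⟦⟧-mod y))
  ⟦⟧-mod (x ⊟ y) = mod-trans (⊖-mod ⟦ x ⟧ ⟦ y ⟧) (minus-cong-mod (⟦⟧-mod x) (⟦⟧-mod y))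

  solve : (x y : Term) → ⟦ x ⟧ℤ ≡ ⟦ y ⟧ℤ → ⟦ x ⟧ ≡ ⟦ y ⟧
  solve x y p = toℤ-injective-mod (mod-trans (⟦⟧-mod x) (mod-trans (mod-reflexive p) (mod-sym (⟦⟧-mod y))))

  ⊕-⊖-cancelʳ : (a b : Fin N) → (a ⊕ b) ⊖ b ≡ a
  ⊕-⊖-cancelʳ a b = solve (` a ⊞ ` b ⊟ ` b) (` a) (ring (toℤ a) (toℤ b))
    where ring : ∀ a b → a + b - b ≡ a
          ring = solve-∀

  ⊖-⊕-cancelʳ : (a b : Fin N) → (a ⊖ b) ⊕ b ≡ a
  ⊖-⊕-cancelʳ a b = solve (` a ⊟ ` b ⊞ ` b) (` a) (ring (toℤ a) (toℤ b))
    where ring : ∀ a b → a - b + b ≡ a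
          ring = solve-∀

  ⊕-⊖-cancelˡ : (a b : Fin N) → (a ⊕ b) ⊖ a ≡ b
  ⊕-⊖-cancelˡ a b = solve (` a ⊞ ` b ⊟ ` a) (` b) (ring (toℤ a) (toℤ b))
    where ring : ∀ a b → a + b - a ≡ b
          ring = solve-∀

  ⊕-⊖-inverse : (a b : Fin N) → a ⊕ (b ⊖ a) ≡ b
  ⊕-⊖-inverse a b = solve (` a ⊞ (` b ⊟ ` a)) (` b) (ring (toℤ a) (toℤ b))
    where ring : ∀ a b → a + (b - a) ≡ b
          ring = solve-∀

  ⊖-self : (a : Fin N) → a ⊖ a ≡ Fin.zero
  ⊖-self a = solve (` a ⊟ ` a) 𝟘 (ring (toℤ a))
    where ring : ∀ a → a - a ≡ + 0
          ring = solve-∀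

-- Parity, and colourings that alternate along a translation

parityℤ : Bool → ℤ
parityℤ true = + 0
parityℤ false = + 1

isEven-suc : ∀ x → isEven (suc x) ≡ not (isEven x)
isEven-suc zero = refl
isEven-suc (suc zero) = refl
isEven-suc (suc (suc x)) = isEven-suc x

isEven-mod : ∀ x → + x ≡ parityℤ (isEven x) mod 2
isEven-mod zero = mod-refl
isEven-mod (suc zero) = mod-refl
isEven-mod (suc (suc x)) = mod-trans (mkMod (+ 1) (trans (cong +_ (ℕₚ.+-comm 2 x)) (ℤₚ.pos-+ x 2))) (isEven-mod x)

parityℤ-injective-mod : ∀ {a b} → parityℤ a ≡ parityℤ b mod 2 → a ≡ b
parityℤ-injective-mod {true} {true} p = refl
parityℤ-injective-mod {false} {false} p = refl
parityℤ-injective-mod {true} {false} p with ≡-mod⇒≡ {2} {0} {1} (s≤s z≤n) (s≤s (s≤s z≤n)) p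
... | ()
parityℤ-injective-mod {false} {true} p with ≡-mod⇒≡ {2} {1} {0} (s≤s (s≤s z≤n)) (s≤s z≤n) p
... | ()

isEven-from-mod : ∀ {x b} → + x ≡ parityℤ b mod 2 → isEven x ≡ b
isEven-from-mod {x} p = parityℤ-injective-mod (mod-trans (mod-sym (isEven-mod x)) p)

isEven⇒2∣ : ∀ {x} → isEven x ≡ true → 2 ∣ x
isEven⇒2∣ {x} e = ≡0-mod⇒∣ (subst (λ b → + x ≡ parityℤ b mod 2) e (isEven-mod x))

2∣⇒isEven : ∀ {x} → 2 ∣ x → isEven x ≡ true
2∣⇒isEven d = isEven-from-mod (∣⇒≡0-mod d)

isEven-cong : ∀ {x y} → (2 ∣ x → 2 ∣ y) → (2 ∣ y → 2 ∣ x) → isEven x ≡ isEven y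
isEven-cong {x} {y} f g with isEven x in ex | isEven y in ey
... | true | true = refl
... | false | false = refl
... | true | false = case trans (sym (2∣⇒isEven (f (isEven⇒2∣ ex)))) ey of λ ()
... | false | true = case trans (sym (2∣⇒isEven (g (isEven⇒2∣ ey)))) ex of λ ()

boundary : (P : ℕ → Set) → (∀ j → Dec (P j)) → P 0 → ∀ K → ¬ P K →
           ∃ λ j → j ℕ.< K × P j × ¬ P (suc j)
boundary P P? p0 zero ¬pK = ⊥-elim (¬pK p0)
boundary P P? p0 (suc K) ¬pK with P? K
... | yes pK = K , ℕₚ.≤-refl , pK , ¬pK
... | no ¬pK' with boundary P P? p0 K ¬pK'
... | j , j<K , pj , ¬pj = j , ℕₚ.m≤n⇒m≤1+n j<K , pj , ¬pj

gcd-nonZero : ∀ N T .{{_ : NonZero N}} → NonZero (gcd N T)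
gcd-nonZero N T = ℕ.≢-nonZero (gcd[m,n]≢0 N T (inj₁ (ℕ.≢-nonZero⁻¹ N)))

div≡/ : ∀ a g .{{_ : NonZero g}} → a div g ≡ a / g
div≡/ a (suc g) = refl

pow-mono-∣ : ∀ {a b} → a ℕ.≤ b → 2 ^ a ∣ 2 ^ b
pow-mono-∣ {a} {b} a≤b =
  divides (2 ^ (b ∸ a)) (trans (cong (2 ^_) (sym (ℕₚ.m∸n+n≡m a≤b))) (ℕₚ.^-distribˡ-+-* 2 (b ∸ a) a))

module _ {m : ℕ} where

  private
    N = suc m

  infix 25 _×ᶠ_

  _×ᶠ_ : ℕ → Fin N → Fin N
  zero ×ᶠ t = Fin.zero
  suc k ×ᶠ t = k ×ᶠ t ⊕ t

  ×ᶠ-mod : ∀ k t → toℤ (k ×ᶠ t) ≡ + k * toℤ t mod N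
  ×ᶠ-mod zero t = mod-refl
  ×ᶠ-mod (suc k) t =
    mod-trans (⊕-mod (k ×ᶠ t) t) (mod-trans (+-cong-mod (×ᶠ-mod k t) mod-refl) (mod-reflexive (ring (+ k) (toℤ t))))
    where ring : ∀ k t → k * t + t ≡ (+ 1 + k) * t
          ring = solve-∀

  Alternating : (Fin N → Bool) → Fin N → Set
  Alternating φ t = ∀ a → φ a ≢ φ (a ⊕ t)

  alternating-iterate : ∀ {φ t} → Alternating φ t → ∀ k a →
                        φ (a ⊕ k ×ᶠ t) ≡ (if isEven k then φ a else not (φ a))
  alternating-iterate {φ} alt zero a = cong φ (solve (` a ⊞ 𝟘) (` a) (ℤₚ.+-identityʳ (toℤ a)))
  alternating-iterate {φ} {t} alt (suc k) a = begin
    φ (a ⊕ (k ×ᶠ t ⊕ t))                          ≡⟨ cong φ (solve (` a ⊞ (` (k ×ᶠ t) ⊞ ` t)) (` a ⊞ ` (k ×ᶠ t) ⊞ ` t)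
                                                                  (sym (ℤₚ.+-assoc (toℤ a) (toℤ (k ×ᶠ t)) (toℤ t)))) ⟩
    φ ((a ⊕ k ×ᶠ t) ⊕ t)                          ≡⟨ ¬-not (λ e → alt (a ⊕ k ×ᶠ t) (sym e)) ⟩
    not (φ (a ⊕ k ×ᶠ t))                          ≡⟨ cong not (alternating-iterate alt k a) ⟩
    not (if isEven k then φ a else not (φ a))     ≡⟨ not-if (isEven k) ⟩
    (if not (isEven k) then φ a else not (φ a))   ≡⟨ cong (if_then φ a else not (φ a)) (sym (isEven-suc k)) ⟩
    (if isEven (suc k) then φ a else not (φ a))   ∎
    where
    open ≡-Reasoning
    not-if : ∀ e → not (if e then φ a else not (φ a)) ≡ (if not e then φ a else not (φ a))
    not-if true = refl
    not-if false = not-involutive (φ a)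

  if-injective : ∀ {e e'} b → (if e then b else not b) ≡ (if e' then b else not b) → e ≡ e'
  if-injective {true} {true} b p = refl
  if-injective {false} {false} b p = refl
  if-injective {true} {false} true ()
  if-injective {true} {false} false ()
  if-injective {false} {true} true ()
  if-injective {false} {true} false ()

  alternating-parity : ∀ {φ t t'} → Alternating φ t → Alternating φ t' → ∀ k k' →
                       + k * toℤ t ≡ + k' * toℤ t' mod N → isEven k ≡ isEven k'
  alternating-parity {φ} {t} {t'} alt alt' k k' p = if-injective (φ Fin.zero) (begin
    _                        ≡⟨ sym (alternating-iterate alt k Fin.zero) ⟩
    φ (Fin.zero ⊕ k ×ᶠ t)    ≡⟨ cong (λ x → φ (Fin.zero ⊕ x)) k×t≡k'×t' ⟩
    φ (Fin.zero ⊕ k' ×ᶠ t')  ≡⟨ alternating-iterate alt' k' Fin.zero ⟩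
    _                        ∎)
    where
    open ≡-Reasoning
    k×t≡k'×t' : k ×ᶠ t ≡ k' ×ᶠ t'
    k×t≡k'×t' = toℤ-injective-mod (mod-trans (×ᶠ-mod k t) (mod-trans p (mod-sym (×ᶠ-mod k' t'))))

  alternating⇒2∣N : ∀ {φ t} → Alternating φ t → 2 ∣ N
  alternating⇒2∣N {t = t} alt = isEven⇒2∣ (alternating-parity alt alt N 0
    (mkMod (toℤ t) (trans (ℤₚ.*-comm (+ N) (toℤ t)) (sym (ℤₚ.+-identityˡ _)))))

  -- N / gcd N t is the order of t in ℤ/N
  alternating⇒even-order : ∀ {φ t} → Alternating φ t → 2 ∣ N div gcd N (toℕ t)
  alternating⇒even-order {t = t} alt =
    subst (2 ∣_) (sym (div≡/ N g)) (isEven⇒2∣ (alternating-parity alt alt M 0 M×t≡0))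
    where
    g = gcd N (toℕ t)
    instance _ = gcd-nonZero N (toℕ t)
    M = N / g
    t′ = quotient (gcd[m,n]∣n N (toℕ t))
    M*t≡t′*N : M ℕ.* toℕ t ≡ t′ ℕ.* N
    M*t≡t′*N = begin
      M ℕ.* toℕ t        ≡⟨ cong (M ℕ.*_) (_∣_.equality (gcd[m,n]∣n N (toℕ t))) ⟩
      M ℕ.* (t′ ℕ.* g)   ≡⟨ ℕ*.x∙yz≈y∙xz M t′ g ⟩
      t′ ℕ.* (M ℕ.* g)   ≡⟨ cong (t′ ℕ.*_) (m/n*n≡m (gcd[m,n]∣m N (toℕ t))) ⟩
      t′ ℕ.* N           ∎
      where open ≡-Reasoning
    M×t≡0 : + M * toℤ t ≡ + 0 * toℤ t mod N
    M×t≡0 = mkMod (+ t′) (trans (sym (ℤₚ.pos-* M (toℕ t)))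
                          (trans (cong +_ M*t≡t′*N) (trans (ℤₚ.pos-* t′ N) (sym (ℤₚ.+-identityˡ _)))))

  alternating-2-valuation : ∀ {φ t t'} → Alternating φ t → Alternating φ t' →
                            ∀ i → 2 ^ i ∣ toℕ t → 2 ^ i ∣ toℕ t'
  alternating-2-valuation {t = t} {t'} alt alt' i 2ⁱ∣t with 2 ^ i ∣? toℕ t'
  ... | yes 2ⁱ∣t' = 2ⁱ∣t'
  ... | no 2ⁱ∤t' with boundary (λ j → 2 ^ j ∣ toℕ t') (λ j → 2 ^ j ∣? toℕ t') (1∣ _) i 2ⁱ∤t'
  ... | j , j<i , divides u t'≡u*2ʲ , 2ʲ⁺¹∤t' =
    ⊥-elim (even≢odd (alternating-parity alt' alt (2 ℕ.* w) u (mod-reflexive 2w*t'≡u*t)))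
    where
    w = quotient (∣-trans (pow-mono-∣ j<i) 2ⁱ∣t)
    2w*t'≡u*t : + (2 ℕ.* w) * toℤ t' ≡ + u * toℤ t
    2w*t'≡u*t = begin
      + (2 ℕ.* w) * toℤ t'            ≡⟨ sym (ℤₚ.pos-* (2 ℕ.* w) (toℕ t')) ⟩
      + (2 ℕ.* w ℕ.* toℕ t')          ≡⟨ cong (λ x → + (2 ℕ.* w ℕ.* x)) t'≡u*2ʲ ⟩
      + (2 ℕ.* w ℕ.* (u ℕ.* 2 ^ j))   ≡⟨ cong +_ (ring w u (2 ^ j)) ⟩
      + (u ℕ.* (w ℕ.* 2 ^ suc j))     ≡⟨ cong (λ x → + (u ℕ.* x)) (sym (_∣_.equality (∣-trans (pow-mono-∣ j<i) 2ⁱ∣t))) ⟩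
      + (u ℕ.* toℕ t)                 ≡⟨ ℤₚ.pos-* u (toℕ t) ⟩
      + u * toℤ t                     ∎
      where
      open ≡-Reasoning
      ring : ∀ w u p → 2 ℕ.* w ℕ.* (u ℕ.* p) ≡ u ℕ.* (w ℕ.* (2 ℕ.* p))
      ring = ℕRing.solve-∀
    even≢odd : isEven (2 ℕ.* w) ≢ isEven u
    even≢odd e with isEven u in eu
    ... | true = 2ʲ⁺¹∤t' (subst (2 ^ suc j ∣_) (sym t'≡u*2ʲ) (*-monoˡ-∣ (2 ^ j) (isEven⇒2∣ {u} eu)))
    ... | false = case trans (sym (2∣⇒isEven (m∣m*n w))) e of λ ()

-- Binary digits

n<2^n : ∀ n → n ℕ.< 2 ^ n
n<2^n zero = s≤s z≤n
n<2^n (suc n) = ℕₚ.+-mono-≤ (ℕₚ.m^n>0 2 n) (ℕₚ.≤-trans (n<2^n n) (ℕₚ.m≤m+n (2 ^ n) 0))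

even-order⇒2-valuation< : ∀ N T .{{_ : NonZero N}} → 2 ∣ N div gcd N T →
  ∃ λ j → 2 ^ j ∣ T × ¬ 2 ^ suc j ∣ T × 2 ^ suc j ∣ N
even-order⇒2-valuation< N T 2∣M
  with boundary (λ j → 2 ^ j ∣ gcd N T) (λ j → 2 ^ j ∣? gcd N T) (1∣ _) (gcd N T)
         (λ 2ᵍ∣g → ℕₚ.<⇒≱ (n<2^n (gcd N T)) (∣⇒≤ {{gcd-nonZero N T}} 2ᵍ∣g))
... | j , _ , 2ʲ∣g , 2ʲ⁺¹∤g = j , ∣-trans 2ʲ∣g (gcd[m,n]∣n N T) , 2ʲ⁺¹∤T , 2ʲ⁺¹∣N
  where
  instance _ = gcd-nonZero N T
  2ʲ⁺¹∣N : 2 ^ suc j ∣ N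
  2ʲ⁺¹∣N = subst (2 ^ suc j ∣_) (m/n*n≡m (gcd[m,n]∣m N T))
             (*-pres-∣ (subst (2 ∣_) (div≡/ N (gcd N T)) 2∣M) 2ʲ∣g)
  2ʲ⁺¹∤T : ¬ 2 ^ suc j ∣ T
  2ʲ⁺¹∤T 2ʲ⁺¹∣T = 2ʲ⁺¹∤g (gcd-greatest 2ʲ⁺¹∣N 2ʲ⁺¹∣T)

parityℤ-suc : ∀ b → parityℤ b + + 1 ≡ parityℤ (not b) mod 2
parityℤ-suc true = mod-refl
parityℤ-suc false = mkMod (+ 1) refl

isEven-+odd : ∀ {x y} → + y ≡ + x + + 1 mod 2 → isEven y ≡ not (isEven x)
isEven-+odd {x} p =
  isEven-from-mod (mod-trans p (mod-trans (+-cong-mod (isEven-mod x) mod-refl) (parityℤ-suc (isEven x))))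

-- bit j x is true when binary digit j of x is 0.
bit : ℕ → ℕ → Bool
bit j x = isEven (_/_ x (2 ^ j) {{ℕₚ.m^n≢0 2 j}})

/-mod : ∀ P .{{_ : NonZero P}} {x y k} → + y ≡ + x + + k * + P mod (2 ℕ.* P) →
        + (y / P) ≡ + (x / P) + + k mod 2
/-mod P {x} {y} {k} p = *-cancelʳ-mod P (begin
  + (y / P) * + P              ≡⟨ pos-[m/n]*n y P ⟩
  + y - + (y % P)              ≈⟨ minus-cong-mod p (mod-reflexive (cong +_ y%P≡x%P)) ⟩
  + x + + k * + P - + (x % P)  ≡⟨ ring (+ x) (+ (x % P)) (+ k) (+ P) ⟩
  + x - + (x % P) + + k * + P  ≡⟨ cong (λ z → z + + k * + P) (sym (pos-[m/n]*n x P)) ⟩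
  + (x / P) * + P + + k * + P  ≡⟨ sym (ℤₚ.*-distribʳ-+ (+ P) (+ (x / P)) (+ k)) ⟩
  (+ (x / P) + + k) * + P      ∎)
  where
  open ≡-mod-Reasoning (2 ℕ.* P)
  ring : ∀ x r k p → x + k * p - r ≡ x - r + k * p
  ring = solve-∀
  y%P≡x%P : y % P ≡ x % P
  y%P≡x%P = mod⇒%≡ (mod-trans (mod-∣-weaken (divides 2 refl) p) (mkMod (+ k) refl))

bit-flip : ∀ {N j T x y} → 2 ^ j ∣ T → ¬ 2 ^ suc j ∣ T → 2 ^ suc j ∣ N →
           + y ≡ + x + + T mod N → bit j y ≡ not (bit j x)
bit-flip {N} {j} {T} {x} {y} (divides T′ T≡T′*2ʲ) 2ʲ⁺¹∤T 2ʲ⁺¹∣N y≡x+T =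
  isEven-+odd {x / 2 ^ j}
    (mod-trans (/-mod (2 ^ j) {k = T′} y≡x+T′*2ʲ) (+-cong-mod {a = + (x / 2 ^ j)} mod-refl T′-odd))
  where
  instance _ = ℕₚ.m^n≢0 2 j
  y≡x+T′*2ʲ : + y ≡ + x + + T′ * + (2 ^ j) mod (2 ^ suc j)
  y≡x+T′*2ʲ = mod-∣-weaken 2ʲ⁺¹∣N
    (subst (λ z → + y ≡ + x + z mod N) (trans (cong +_ T≡T′*2ʲ) (ℤₚ.pos-* T′ (2 ^ j))) y≡x+T)
  T′-odd : + T′ ≡ + 1 mod 2
  T′-odd with isEven T′ in e
  ... | true = ⊥-elim (2ʲ⁺¹∤T (subst (2 ^ suc j ∣_) (sym T≡T′*2ʲ) (*-monoˡ-∣ (2 ^ j) (isEven⇒2∣ {T′} e))))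
  ... | false = subst (λ b → + T′ ≡ parityℤ b mod 2) e (isEven-mod T′)

-- Separating pairs of residues

straddle : ∀ {u u' L} → u ℕ.+ u' ≡ L ℕ.+ L → u ≢ u' → (u ℕ.< L × L ℕ.< u') ⊎ (u' ℕ.< L × L ℕ.< u)
straddle {u} {u'} {L} e u≢u' with ℕₚ.<-cmp u L | ℕₚ.<-cmp u' L
... | tri≈ _ u≡L _ | tri≈ _ u'≡L _ = ⊥-elim (u≢u' (trans u≡L (sym u'≡L)))
... | tri< u<L _ _ | tri> _ _ L<u' = inj₁ (u<L , L<u')
... | tri> _ _ L<u | tri< u'<L _ _ = inj₂ (u'<L , L<u)
... | tri< u<L _ _ | tri< u'<L _ _ = ⊥-elim (ℕₚ.<-irrefl e (ℕₚ.+-mono-< u<L u'<L))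
... | tri< u<L _ _ | tri≈ _ u'≡L _ = ⊥-elim (ℕₚ.<-irrefl e (ℕₚ.+-mono-<-≤ u<L (ℕₚ.≤-reflexive u'≡L)))
... | tri≈ _ u≡L _ | tri< u'<L _ _ = ⊥-elim (ℕₚ.<-irrefl e (ℕₚ.+-mono-≤-< (ℕₚ.≤-reflexive u≡L) u'<L))
... | tri> _ _ L<u | tri> _ _ L<u' = ⊥-elim (ℕₚ.<-irrefl (sym e) (ℕₚ.+-mono-< L<u L<u'))
... | tri> _ _ L<u | tri≈ _ u'≡L _ = ⊥-elim (ℕₚ.<-irrefl (sym e) (ℕₚ.+-mono-<-≤ L<u (ℕₚ.≤-reflexive (sym u'≡L))))
... | tri≈ _ u≡L _ | tri> _ _ L<u' = ⊥-elim (ℕₚ.<-irrefl (sym e) (ℕₚ.+-mono-≤-< (ℕₚ.≤-reflexive (sym u≡L)) L<u'))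

straddle⇒<?-differs : ∀ {u u' L} → (u ℕ.< L × L ℕ.< u') ⊎ (u' ℕ.< L × L ℕ.< u) → does (u <? L) ≢ does (u' <? L)
straddle⇒<?-differs {u} {u'} {L} (inj₁ (u<L , L<u')) e =
  case trans (sym (dec-true (u <? L) u<L)) (trans e (dec-false (u' <? L) (ℕₚ.<⇒≯ L<u'))) of λ ()
straddle⇒<?-differs {u} {u'} {L} (inj₂ (u'<L , L<u)) e =
  case trans (sym (dec-false (u <? L) (ℕₚ.<⇒≯ L<u))) (trans e (dec-true (u' <? L) u'<L)) of λ ()

lower-half-separates : ∀ {g r r'} → r ℕ.< g → r' ℕ.< g → + (r ℕ.+ r') ≡ + 0 mod g →
                       r ≢ 0 → 2 ℕ.* r ≢ g → does (2 ℕ.* r <? g) ≢ does (2 ℕ.* r' <? g)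
lower-half-separates {g} {r} {r'} r<g r'<g r+r'≡0 r≢0 2r≢g
  with residue-sum r<g r'<g (ℕₚ.≤-<-trans z≤n r<g) r+r'≡0
... | inj₁ r+r'≡0 = ⊥-elim (r≢0 (ℕₚ.m+n≡0⇒m≡0 r r+r'≡0))
... | inj₂ r+r'≡g = straddle⇒<?-differs {L = g} (straddle 2r+2r'≡g+g 2r≢2r')
  where
  2r+2r'≡g+g : 2 ℕ.* r ℕ.+ 2 ℕ.* r' ≡ g ℕ.+ g
  2r+2r'≡g+g = trans (sym (ℕₚ.*-distribˡ-+ 2 r r')) (trans (cong (2 ℕ.*_) r+r'≡g) (cong (g ℕ.+_) (ℕₚ.+-identityʳ g)))
  2r≢2r' : 2 ℕ.* r ≢ 2 ℕ.* r'
  2r≢2r' e = 2r≢g (trans (cong (r ℕ.+_) (trans (ℕₚ.+-identityʳ r) (ℕₚ.*-cancelˡ-≡ r r' 2 e))) r+r'≡g)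

positive-summand : ∀ {u u' K} → u ℕ.+ u' ≡ K → u' ℕ.< K → 0 ℕ.< u
positive-summand {zero} refl u'<K = ⊥-elim (ℕₚ.<-irrefl refl u'<K)
positive-summand {suc u} _ _ = s≤s z≤n

-- The arc {1, …, M} of ℤ/2M: it separates the pairs {i, -i} and {i, 2 - i}.
arc : ℕ → ℕ → Bool
arc M i = does (0 <? i) ∧ does (i ≤? M)

arc-differs : ∀ {M u u'} → 0 ℕ.< u → u ℕ.≤ M → M ℕ.< u' → arc M u ≢ arc M u'
arc-differs {M} {u} {u'} 0<u u≤M M<u' e = case trans (sym arc-u) (trans e arc-u') of λ ()
  where
  arc-u : arc M u ≡ true
  arc-u = cong₂ _∧_ (dec-true (0 <? u) 0<u) (dec-true (u ≤? M) u≤M)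
  arc-u' : arc M u' ≡ false
  arc-u' = trans (cong (does (0 <? u') ∧_) (dec-false (u' ≤? M) (ℕₚ.<⇒≱ M<u'))) (∧-zeroʳ _)

arc-separates-sum : ∀ {M L i i'} → M ℕ.≤ L → L ℕ.≤ suc M → i ℕ.< L ℕ.+ L → i' ℕ.< L ℕ.+ L →
                    i ℕ.+ i' ≡ L ℕ.+ L → i ≢ i' → arc M i ≢ arc M i'
arc-separates-sum {M} {L} {i} {i'} M≤L L≤1+M i<2L i'<2L i+i'≡2L i≢i' with straddle i+i'≡2L i≢i'
... | inj₁ (i<L , L<i') =
  arc-differs (positive-summand i+i'≡2L i'<2L) (ℕₚ.≤-pred (ℕₚ.<-≤-trans i<L L≤1+M)) (ℕₚ.≤-<-trans M≤L L<i')
... | inj₂ (i'<L , L<i) =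
  ≢-sym (arc-differs (positive-summand (trans (ℕₚ.+-comm i' i) i+i'≡2L) i<2L)
                     (ℕₚ.≤-pred (ℕₚ.<-≤-trans i'<L L≤1+M)) (ℕₚ.≤-<-trans M≤L L<i))

arc-separates₀ : ∀ {M i i'} → i ℕ.< 2 ℕ.* M → i' ℕ.< 2 ℕ.* M → + (i ℕ.+ i') ≡ + 0 mod (2 ℕ.* M) →
                 i ≢ i' → arc M i ≢ arc M i'
arc-separates₀ {M} {i} {i'} i<2M i'<2M i+i'≡0 i≢i' with residue-sum i<2M i'<2M (ℕₚ.≤-<-trans z≤n i<2M) i+i'≡0
... | inj₁ i+i'≡0 = ⊥-elim (i≢i' (trans (ℕₚ.m+n≡0⇒m≡0 i i+i'≡0) (sym (ℕₚ.m+n≡0⇒n≡0 i i+i'≡0))))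
... | inj₂ i+i'≡2M = arc-separates-sum ℕₚ.≤-refl (ℕₚ.n≤1+n M) (subst (i ℕ.<_) 2M≡M+M i<2M)
                        (subst (i' ℕ.<_) 2M≡M+M i'<2M) (trans i+i'≡2M 2M≡M+M) i≢i'
  where
  2M≡M+M : 2 ℕ.* M ≡ M ℕ.+ M
  2M≡M+M = cong (M ℕ.+_) (ℕₚ.+-identityʳ M)

distinct-bits : ∀ {i i'} → i ℕ.< 2 → i' ℕ.< 2 → i ≢ i' → i ℕ.+ i' ≡ 1
distinct-bits {0} {0} _ _ i≢i' = ⊥-elim (i≢i' refl)
distinct-bits {0} {1} _ _ _ = refl
distinct-bits {1} {0} _ _ _ = refl
distinct-bits {1} {1} _ _ i≢i' = ⊥-elim (i≢i' refl)
distinct-bits {suc (suc _)} (s≤s (s≤s ()))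
distinct-bits {_} {suc (suc _)} _ (s≤s (s≤s ()))

arc-separates-small : ∀ {M i i'} → 2 ℕ.≤ M → i ℕ.+ i' ≡ 2 → i ≢ i' → arc M i ≢ arc M i'
arc-separates-small {M} {0} {2} 2≤M _ _ e = case trans e (cong (true ∧_) (dec-true (2 ≤? M) 2≤M)) of λ ()
arc-separates-small {M} {2} {0} 2≤M _ _ e = case trans (sym e) (cong (true ∧_) (dec-true (2 ≤? M) 2≤M)) of λ ()
arc-separates-small {M} {1} {1} _ _ i≢i' = ⊥-elim (i≢i' refl)
arc-separates-small {M} {0} {suc (suc (suc _))} _ ()
arc-separates-small {M} {1} {suc (suc _)} _ ()
arc-separates-small {M} {suc (suc (suc _))} {_} _ ()
arc-separates-small {M} {2} {suc _} _ ()
arc-separates-small {M} {1} {0} _ ()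
arc-separates-small {M} {0} {0} _ ()
arc-separates-small {M} {0} {1} _ ()

arc-separates₂ : ∀ {M i i'} → i ℕ.< 2 ℕ.* M → i' ℕ.< 2 ℕ.* M → + (i ℕ.+ i') ≡ + 2 mod (2 ℕ.* M) →
                 i ≢ i' → arc M i ≢ arc M i'
arc-separates₂ {suc zero} {i} {i'} i<2 i'<2 i+i'≡2 i≢i' = ⊥-elim (1≢0 (≡-mod⇒≡ (s≤s (s≤s z≤n)) (s≤s z≤n) 1≡0))
  where
  1≡0 : + 1 ≡ + 0 mod 2
  1≡0 = mod-trans (mod-reflexive (cong +_ (sym (distinct-bits i<2 i'<2 i≢i')))) (mod-trans i+i'≡2 (mkMod (+ 1) refl))
  1≢0 : 1 ≢ 0
  1≢0 ()
arc-separates₂ {M@(suc (suc _))} {i} {i'} i<2M i'<2M i+i'≡2 i≢i'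
  with residue-sum i<2M i'<2M (ℕₚ.*-monoʳ-< 2 {1} {M} (s≤s (s≤s z≤n))) i+i'≡2
... | inj₁ i+i'≡2 = arc-separates-small (s≤s (s≤s z≤n)) i+i'≡2 i≢i'
... | inj₂ i+i'≡2+2M = arc-separates-sum (ℕₚ.n≤1+n M) ℕₚ.≤-refl (ℕₚ.<-trans i<2M 2M<2L)
                          (ℕₚ.<-trans i'<2M 2M<2L) (trans i+i'≡2+2M (ring M)) i≢i'
  where
  ring : ∀ M → 2 ℕ.+ 2 ℕ.* M ≡ suc M ℕ.+ suc M
  ring = ℕRing.solve-∀
  2M<2L : 2 ℕ.* M ℕ.< suc M ℕ.+ suc M
  2M<2L = subst (2 ℕ.* M ℕ.<_) (ring M) (ℕₚ.m<n+m (2 ℕ.* M) {2} (s≤s z≤n))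

-- A colouring of ℤ/N separating the pairs of two reflections

unit-cancel-mod : ∀ {M a b} α β → α * β ≡ + 1 mod M → a ≡ b mod 2 →
                  α * a ≡ α * b mod (2 ℕ.* M) → a ≡ b mod (2 ℕ.* M)
unit-cancel-mod {M} {a} {b} α β αβ≡1 (mkMod q a≡b+q2) αa≡αb =
  let open ≡-mod-Reasoning (2 ℕ.* M) in begin
  a                    ≡⟨ a≡b+q2 ⟩
  b + q * + 2          ≡⟨ cong (_+_ b) (ℤₚ.*-comm q (+ 2)) ⟩
  b + + 2 * q          ≈⟨ +-cong-mod (mod-refl {a = b}) (*-scaleˡ-mod 2 q≡0) ⟩
  b + + 2 * + 0        ≡⟨ ℤₚ.+-identityʳ b ⟩
  b                    ∎
  where
  αq≡0 : α * q ≡ + 0 mod M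
  αq≡0 = *-cancelˡ-mod 2 (begin
    + 2 * (α * q)            ≡⟨ ring α b q ⟩
    α * (b + q * + 2) - α * b ≡⟨ cong (λ z → α * z - α * b) (sym a≡b+q2) ⟩
    α * a - α * b            ≈⟨ minus-cong-mod αa≡αb mod-refl ⟩
    α * b - α * b            ≡⟨ ring′ α b ⟩
    + 2 * + 0                ∎)
    where
    open ≡-mod-Reasoning (2 ℕ.* M)
    ring : ∀ α b q → + 2 * (α * q) ≡ α * (b + q * + 2) - α * b
    ring = solve-∀
    ring′ : ∀ α b → α * b - α * b ≡ + 2 * + 0
    ring′ = solve-∀
  q≡0 : q ≡ + 0 mod M
  q≡0 = begin
    q              ≡⟨ sym (ℤₚ.*-identityʳ q) ⟩
    q * + 1        ≈⟨ *-congˡ-mod q (mod-sym αβ≡1) ⟩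
    q * (α * β)    ≡⟨ ring q α β ⟩
    β * (α * q)    ≈⟨ *-congˡ-mod β αq≡0 ⟩
    β * + 0        ≡⟨ ℤₚ.*-zeroʳ β ⟩
    + 0            ∎
    where
    open ≡-mod-Reasoning M
    ring : ∀ q α β → q * (α * β) ≡ β * (α * q)
    ring = solve-∀

reflection-sym : ∀ {N x x' c} → x' ≡ c - x mod N → x ≡ c - x' mod N
reflection-sym {N} {x} {x'} {c} p = begin
  x              ≡⟨ ring c x ⟩
  c - (c - x)    ≈⟨ minus-cong-mod (mod-refl {a = c}) (mod-sym p) ⟩
  c - x'         ∎
  where
  open ≡-mod-Reasoning N
  ring : ∀ c x → x ≡ c - (c - x)
  ring = solve-∀

pos-bézout : ∀ {g x y m n} → g ℕ.+ x ℕ.* m ≡ y ℕ.* n → + g + + x * + m ≡ + y * + n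
pos-bézout {g} {x} {y} {m} {n} e = trans (sym (pos-+* g x m)) (trans (cong +_ e) (ℤₚ.pos-* y n))

module ReflectionColouring (N D : ℕ) {{_ : NonZero N}} where

  g M β : ℕ
  g = gcd N D
  instance
    g≢0 : NonZero g
    g≢0 = gcd-nonZero N D
  M = N / g
  β = D / g

  g*M≡N : g ℕ.* M ≡ N
  g*M≡N = trans (ℕₚ.*-comm g M) (m/n*n≡m (gcd[m,n]∣m N D))

  g*β≡D : g ℕ.* β ≡ D
  g*β≡D = trans (ℕₚ.*-comm g β) (m/n*n≡m (gcd[m,n]∣n N D))

  instance
    M≢0 : NonZero M
    M≢0 = ℕ.≢-nonZero (λ M≡0 → ℕ.≢-nonZero⁻¹ N (trans (sym g*M≡N) (trans (cong (g ℕ.*_) M≡0) (ℕₚ.*-zeroʳ g))))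
    2M≢0 : NonZero (2 ℕ.* M)
    2M≢0 = ℕₚ.m*n≢0 2 M

  bézout : ∃ λ α → α * + D ≡ + g mod N
  bézout with Bézout.identity (gcd-GCD N D)
  ... | Bézout.+- x y g+yD≡xN = - + y , mkMod (- + x) (begin
    - + y * + D               ≡⟨ ring (+ g) (+ y) (+ D) ⟩
    + g - (+ g + + y * + D)   ≡⟨ cong (_-_ (+ g)) (pos-bézout {g} {y} {x} {D} {N} g+yD≡xN) ⟩
    + g - + x * + N           ≡⟨ cong (_+_ (+ g)) (ℤₚ.neg-distribˡ-* (+ x) (+ N)) ⟩
    + g + - + x * + N         ∎)
    where
    open ≡-Reasoning
    ring : ∀ g y d → - y * d ≡ g - (g + y * d)
    ring = solve-∀
  ... | Bézout.-+ x y g+xN≡yD = + y , mkMod (+ x) (sym (pos-bézout {g} {x} {y} {N} {D} g+xN≡yD))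

  α : ℤ
  α = proj₁ bézout

  αD≡g : α * + D ≡ + g mod N
  αD≡g = proj₂ bézout

  αβ≡1 : α * + β ≡ + 1 mod M
  αβ≡1 = *-cancelˡ-mod g (begin
    + g * (α * + β)   ≡⟨ ring (+ g) α (+ β) ⟩
    α * (+ g * + β)   ≡⟨ cong (α *_) (trans (sym (ℤₚ.pos-* g β)) (cong +_ g*β≡D)) ⟩
    α * + D           ≈⟨ mod-≡-modulus (sym g*M≡N) αD≡g ⟩
    + g               ≡⟨ sym (ℤₚ.*-identityʳ (+ g)) ⟩
    + g * + 1         ∎)
    where
    open ≡-mod-Reasoning (g ℕ.* M)
    ring : ∀ g α β → g * (α * β) ≡ α * (g * β)
    ring = solve-∀

  -- Both reflections preserve the set of x with g ∣ 2x. On it, w = 2x/g is a coordinate in ℤ/2M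
  -- in which the reflections read w ↦ -w and w ↦ 2β - w, and multiplying by α (a unit with
  -- αβ ≡ 1 mod M) turns them into i ↦ -i and i ↦ 2 - i, which the arc {1, …, M} separates.
  -- Off that set, x and its images lie in the cosets of ±x modulo g, separated by 2(x mod g) < g.
  coordinate : ℕ → ℕ
  coordinate x = 2 ℕ.* x / g

  index : ℕ → ℕ
  index x = (α * + coordinate x) %ℕ (2 ℕ.* M)

  colour : ℕ → Bool
  colour x with g ∣? 2 ℕ.* x
  ... | yes _ = arc M (index x)
  ... | no _ = does (2 ℕ.* (x % g) <? g)

  private
    g∣N : g ∣ N
    g∣N = gcd[m,n]∣m N D

  reflection-mod-g : ∀ {γ x x'} → + x' ≡ + (γ ℕ.* g) - + x mod N → + x' ≡ - + x mod g
  reflection-mod-g {γ} {x} {x'} p = begin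
    + x'                   ≈⟨ mod-∣-weaken g∣N p ⟩
    + (γ ℕ.* g) - + x      ≈⟨ minus-cong-mod (∣⇒≡0-mod (divides γ refl)) (mod-refl {a = + x}) ⟩
    + 0 - + x              ≡⟨ ℤₚ.+-identityˡ (- + x) ⟩
    - + x                  ∎
    where open ≡-mod-Reasoning g

  centre-closed : ∀ {x x'} → + x' ≡ - + x mod g → g ∣ 2 ℕ.* x → g ∣ 2 ℕ.* x'
  centre-closed {x} {x'} p g∣2x = ≡0-mod⇒∣ (begin
    + (2 ℕ.* x')       ≡⟨ ℤₚ.pos-* 2 x' ⟩
    + 2 * + x'         ≈⟨ *-congˡ-mod (+ 2) p ⟩
    + 2 * - + x        ≡⟨ sym (ℤₚ.neg-distribʳ-* (+ 2) (+ x)) ⟩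
    - (+ 2 * + x)      ≡⟨ cong -_ (sym (ℤₚ.pos-* 2 x)) ⟩
    - + (2 ℕ.* x)      ≈⟨ neg-cong-mod (∣⇒≡0-mod g∣2x) ⟩
    - + 0              ∎)
    where open ≡-mod-Reasoning g

  off-centre-separates : ∀ {x x'} → + x' ≡ - + x mod g → ¬ g ∣ 2 ℕ.* x →
                         does (2 ℕ.* (x % g) <? g) ≢ does (2 ℕ.* (x' % g) <? g)
  off-centre-separates {x} {x'} p g∤2x =
    lower-half-separates (m%n<n x g) (m%n<n x' g) r+r'≡0 r≢0 2r≢g
    where
    r+r'≡0 : + (x % g ℕ.+ x' % g) ≡ + 0 mod g
    r+r'≡0 = begin
      + (x % g ℕ.+ x' % g)      ≡⟨ ℤₚ.pos-+ (x % g) (x' % g) ⟩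
      + (x % g) + + (x' % g)    ≈⟨ +-cong-mod (%-mod x) (mod-trans (%-mod x') p) ⟩
      + x + - + x               ≡⟨ ℤₚ.+-inverseʳ (+ x) ⟩
      + 0                       ∎
      where open ≡-mod-Reasoning g
    r≢0 : x % g ≢ 0
    r≢0 r≡0 = g∤2x (∣n⇒∣m*n 2 (m%n≡0⇒n∣m x g r≡0))
    2r≢g : 2 ℕ.* (x % g) ≢ g
    2r≢g 2r≡g = g∤2x (≡0-mod⇒∣ (begin
      + (2 ℕ.* x)            ≡⟨ ℤₚ.pos-* 2 x ⟩
      + 2 * + x              ≈⟨ *-congˡ-mod (+ 2) (mod-sym (%-mod x)) ⟩
      + 2 * + (x % g)        ≡⟨ sym (ℤₚ.pos-* 2 (x % g)) ⟩
      + (2 ℕ.* (x % g))      ≡⟨ cong +_ 2r≡g ⟩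
      + g                    ≈⟨ ∣⇒≡0-mod (∣-refl {g}) ⟩
      + 0                    ∎))
      where open ≡-mod-Reasoning g

  g*coordinate : ∀ x → g ∣ 2 ℕ.* x → g ℕ.* coordinate x ≡ 2 ℕ.* x
  g*coordinate x = m*[n/m]≡n

  2N≡g*2M : 2 ℕ.* N ≡ g ℕ.* (2 ℕ.* M)
  2N≡g*2M = trans (cong (2 ℕ.*_) (sym g*M≡N)) (ℕ*.x∙yz≈y∙xz 2 g M)

  coordinate<2M : ∀ {x} → x ℕ.< N → g ∣ 2 ℕ.* x → coordinate x ℕ.< 2 ℕ.* M
  coordinate<2M {x} x<N g∣2x = ℕₚ.*-cancelˡ-< g (coordinate x) (2 ℕ.* M)
    (subst₂ ℕ._<_ (sym (g*coordinate x g∣2x)) 2N≡g*2M (ℕₚ.*-monoʳ-< 2 x<N))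

  coordinate-reflection : ∀ {γ x x'} → + x' ≡ + (γ ℕ.* g) - + x mod N → g ∣ 2 ℕ.* x → g ∣ 2 ℕ.* x' →
                          + coordinate x' ≡ + (2 ℕ.* γ) - + coordinate x mod (2 ℕ.* M)
  coordinate-reflection {γ} {x} {x'} p g∣2x g∣2x' = *-cancelˡ-mod g (begin
    + g * + coordinate x'                      ≡⟨ pos-g*coordinate x' g∣2x' ⟩
    + 2 * + x'                                 ≈⟨ mod-≡-modulus 2N≡g*2M (*-scaleˡ-mod 2 p) ⟩
    + 2 * (+ (γ ℕ.* g) - + x)                  ≡⟨ cong (λ z → + 2 * (z - + x)) (ℤₚ.pos-* γ g) ⟩
    + 2 * (+ γ * + g - + x)                    ≡⟨ ring (+ γ) (+ g) (+ x) (+ coordinate x) (pos-g*coordinate x g∣2x) ⟩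
    + g * (+ 2 * + γ - + coordinate x)         ≡⟨ cong (λ z → + g * (z - + coordinate x)) (sym (ℤₚ.pos-* 2 γ)) ⟩
    + g * (+ (2 ℕ.* γ) - + coordinate x)       ∎)
    where
    open ≡-mod-Reasoning (g ℕ.* (2 ℕ.* M))
    pos-g*coordinate : ∀ y → g ∣ 2 ℕ.* y → + g * + coordinate y ≡ + 2 * + y
    pos-g*coordinate y g∣2y =
      trans (sym (ℤₚ.pos-* g (coordinate y))) (trans (cong +_ (g*coordinate y g∣2y)) (ℤₚ.pos-* 2 y))
    ring : ∀ γ g x w → g * w ≡ + 2 * x → + 2 * (γ * g - x) ≡ g * (+ 2 * γ - w)
    ring γ g x w e = trans (ring₁ γ g x) (trans (cong (λ z → + 2 * γ * g - z) (sym e)) (ring₂ γ g w))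
      where
      ring₁ : ∀ γ g x → + 2 * (γ * g - x) ≡ + 2 * γ * g - + 2 * x
      ring₁ = solve-∀
      ring₂ : ∀ γ g w → + 2 * γ * g - g * w ≡ g * (+ 2 * γ - w)
      ring₂ = solve-∀

  index-sum : ∀ {γ ε x x'} → α * + γ ≡ + ε mod M → + x' ≡ + (γ ℕ.* g) - + x mod N →
              g ∣ 2 ℕ.* x → g ∣ 2 ℕ.* x' → + (index x ℕ.+ index x') ≡ + (2 ℕ.* ε) mod (2 ℕ.* M)
  index-sum {γ} {ε} {x} {x'} αγ≡ε p g∣2x g∣2x' = begin
    + (index x ℕ.+ index x')                           ≡⟨ ℤₚ.pos-+ (index x) (index x') ⟩
    + (index x ℕ.+ index x')      ≡⟨ ℤₚ.pos-+ (index x) (index x') ⟩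
    + index x + + index x'        ≈⟨ +-cong-mod (%ℕ-mod (α * + w) (2 ℕ.* M)) (%ℕ-mod (α * + w') (2 ℕ.* M)) ⟩
    α * + w + α * + w'            ≈⟨ +-cong-mod (mod-refl {a = α * + w}) (*-congˡ-mod α w'≡2γ-w) ⟩
    α * + w + α * (+ (2 ℕ.* γ) - + w) ≡⟨ cong (λ z → α * + w + α * (z - + w)) (ℤₚ.pos-* 2 γ) ⟩
    α * + w + α * (+ 2 * + γ - + w)   ≡⟨ ring α (+ w) (+ γ) ⟩
    + 2 * (α * + γ)               ≈⟨ *-scaleˡ-mod 2 αγ≡ε ⟩
    + 2 * + ε                     ≡⟨ sym (ℤₚ.pos-* 2 ε) ⟩
    + (2 ℕ.* ε)                   ∎
    where
    open ≡-mod-Reasoning (2 ℕ.* M)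
    w = coordinate x
    w' = coordinate x'
    w'≡2γ-w = coordinate-reflection {γ} {x} {x'} p g∣2x g∣2x'
    ring : ∀ α w γ → α * w + α * (+ 2 * γ - w) ≡ + 2 * (α * γ)
    ring = solve-∀

  index-injective : ∀ {γ x x'} → x ℕ.< N → x' ℕ.< N → + x' ≡ + (γ ℕ.* g) - + x mod N →
                    g ∣ 2 ℕ.* x → g ∣ 2 ℕ.* x' → index x ≡ index x' → x ≡ x'
  index-injective {γ} {x} {x'} x<N x'<N p g∣2x g∣2x' i≡i' =
    ℕₚ.*-cancelˡ-≡ x x' 2 (trans (sym (g*coordinate x g∣2x)) (trans (cong (g ℕ.*_) w≡w') (g*coordinate x' g∣2x')))
    where
    w w' : ℕ
    w = coordinate x
    w' = coordinate x'
    w≡w'[2] : + w ≡ + w' mod 2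
    w≡w'[2] = mod-sym (begin
      + w'                       ≈⟨ mod-∣-weaken 2∣2M (coordinate-reflection {γ} {x} {x'} p g∣2x g∣2x') ⟩
      + (2 ℕ.* γ) - + w          ≡⟨ cong (_- + w) (ℤₚ.pos-* 2 γ) ⟩
      + 2 * + γ - + w            ≡⟨ ring (+ γ) (+ w) ⟩
      + w + (+ γ - + w) * + 2    ≈⟨ mkMod (+ γ - + w) refl ⟩
      + w                        ∎)
      where
      open ≡-mod-Reasoning 2
      2∣2M = divides M (ℕₚ.*-comm 2 M)
      ring : ∀ γ w → + 2 * γ - w ≡ w + (γ - w) * + 2
      ring = solve-∀
    αw≡αw' : α * + w ≡ α * + w' mod (2 ℕ.* M)
    αw≡αw' = mod-trans (mod-sym (%ℕ-mod (α * + w) (2 ℕ.* M)))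
                       (mod-trans (mod-reflexive (cong +_ i≡i')) (%ℕ-mod (α * + w') (2 ℕ.* M)))
    w≡w' : w ≡ w'
    w≡w' = ≡-mod⇒≡ (coordinate<2M x<N g∣2x) (coordinate<2M x'<N g∣2x') (unit-cancel-mod α (+ β) αβ≡1 w≡w'[2] αw≡αw')

  centre-separates : ∀ {γ ε x x'} → α * + γ ≡ + ε mod M → ε ≡ 0 ⊎ ε ≡ 1 → x ℕ.< N → x' ℕ.< N →
                     + x' ≡ + (γ ℕ.* g) - + x mod N → x ≢ x' → g ∣ 2 ℕ.* x → g ∣ 2 ℕ.* x' →
                     arc M (index x) ≢ arc M (index x')
  centre-separates {γ} {ε} {x} {x'} αγ≡ε ε∈01 x<N x'<N p x≢x' g∣2x g∣2x' = separates ε∈01 i+i'≡2ε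
    where
    i<2M = n%ℕd<d (α * + coordinate x) (2 ℕ.* M)
    i'<2M = n%ℕd<d (α * + coordinate x') (2 ℕ.* M)
    i≢i' : index x ≢ index x'
    i≢i' i≡i' = x≢x' (index-injective {γ} x<N x'<N p g∣2x g∣2x' i≡i')
    i+i'≡2ε = index-sum {γ} {ε} {x} {x'} αγ≡ε p g∣2x g∣2x'
    separates : ε ≡ 0 ⊎ ε ≡ 1 → + (index x ℕ.+ index x') ≡ + (2 ℕ.* ε) mod (2 ℕ.* M) →
                arc M (index x) ≢ arc M (index x')
    separates (inj₁ refl) i+i'≡0 = arc-separates₀ i<2M i'<2M i+i'≡0 i≢i'
    separates (inj₂ refl) i+i'≡2 = arc-separates₂ i<2M i'<2M i+i'≡2 i≢i'

  colour-separates : ∀ {γ ε x x'} → α * + γ ≡ + ε mod M → ε ≡ 0 ⊎ ε ≡ 1 → x ℕ.< N → x' ℕ.< N →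
                     + x' ≡ + (γ ℕ.* g) - + x mod N → x ≢ x' → colour x ≢ colour x'
  colour-separates {γ} {x = x} {x'} αγ≡ε ε∈01 x<N x'<N p x≢x' with g ∣? 2 ℕ.* x | g ∣? 2 ℕ.* x'
  ... | yes g∣2x | no g∤2x' = ⊥-elim (g∤2x' (centre-closed x'≡-x g∣2x))
    where x'≡-x = reflection-mod-g {γ} {x} {x'} p
  ... | no g∤2x | yes g∣2x' = ⊥-elim (g∤2x (centre-closed x≡-x' g∣2x'))
    where x≡-x' = reflection-mod-g {γ} {x'} {x} (reflection-sym {c = + (γ ℕ.* g)} p)
  ... | no g∤2x | no _ = off-centre-separates (reflection-mod-g {γ} {x} {x'} p) g∤2x
  ... | yes g∣2x | yes g∣2x' = centre-separates αγ≡ε ε∈01 x<N x'<N p x≢x' g∣2x g∣2x'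

two-reflection-colouring : ∀ {m} (d : Fin (suc m)) → ∃ λ (ρ : Fin (suc m) → Bool) →
  (∀ a → a ≢ neg a → ρ a ≢ ρ (neg a)) × (∀ a → a ≢ d ⊖ a → ρ a ≢ ρ (d ⊖ a))
two-reflection-colouring {m} d = (λ a → colour (toℕ a)) , separates-neg , separates-d
  where
  open ReflectionColouring (suc m) (toℕ d)
  separates-neg : ∀ a → a ≢ neg a → colour (toℕ a) ≢ colour (toℕ (neg a))
  separates-neg a a≢-a = colour-separates {γ = 0} (mod-reflexive (ℤₚ.*-zeroʳ α)) (inj₁ refl)
    (toℕ<n a) (toℕ<n (neg a)) (⊖-mod Fin.zero a) (a≢-a ∘ toℕ-injective)
  separates-d : ∀ a → a ≢ d ⊖ a → colour (toℕ a) ≢ colour (toℕ (d ⊖ a))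
  separates-d a a≢d-a = colour-separates {γ = β} αβ≡1 (inj₂ refl)
    (toℕ<n a) (toℕ<n (d ⊖ a)) d-a≡βg-a (a≢d-a ∘ toℕ-injective)
    where
    d-a≡βg-a : toℤ (d ⊖ a) ≡ + (β ℕ.* g) - toℤ a mod suc m
    d-a≡βg-a = subst (λ D → toℤ (d ⊖ a) ≡ + D - toℤ a mod suc m) (trans (sym g*β≡D) (ℕₚ.*-comm g β)) (⊖-mod d a)

-- What an avoiding colouring forces

rot-injective : ∀ {n} {a b : Fin n} → rot a ≡ rot b → a ≡ b
rot-injective refl = refl

ref-injective : ∀ {n} {a b : Fin n} → ref a ≡ ref b → a ≡ b
ref-injective refl = refl

infix 4 _∈_ _∉_

_∈_ _∉_ : ∀ {n} → Dih n → Subset n → Set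
x ∈ U = U x ≡ true
x ∉ U = U x ≢ true

rot∈-resp : ∀ {n} (V : Subset n) {a b} → a ≡ b → rot a ∈ V → rot b ∈ V
rot∈-resp V refl a∈V = a∈V

Avoids : ∀ {n} → (Dih n → Bool) → Subset n → Set
Avoids c U = ∀ x y → x ≢ y → c x ≡ c y → U (x · y) ≡ false

even-not-alternating-by-double : ∀ {m} {f : Fin (suc m) → Bool} {t h} → (∀ x → f x ≡ f (neg x)) →
                                 (∀ x → f (x ⊕ t) ≡ not (f x)) → h ⊕ h ≢ t
even-not-alternating-by-double {f = f} {t} {h} f-even f-alt 2h≡t = not-¬ refl (begin
  f h                 ≡⟨ cong f (sym -h+2h≡h) ⟩
  f (neg h ⊕ (h ⊕ h)) ≡⟨ cong (λ z → f (neg h ⊕ z)) 2h≡t ⟩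
  f (neg h ⊕ t)       ≡⟨ f-alt (neg h) ⟩
  not (f (neg h))     ≡⟨ cong not (sym (f-even h)) ⟩
  not (f h)           ∎)
  where
  open ≡-Reasoning
  ring : ∀ h → + 0 - h + (h + h) ≡ h
  ring = solve-∀
  -h+2h≡h : neg h ⊕ (h ⊕ h) ≡ h
  -h+2h≡h = solve (𝟘 ⊟ ` h ⊞ (` h ⊞ ` h)) (` h) (ring (toℤ h))

module Triangle {m : ℕ} {t₁ t₂ t₃ h : Fin (suc m)} (2h≡t : h ⊕ h ≡ (t₁ ⊖ t₂) ⊕ t₃) where

  open ≡-Reasoning

  triangle-fixed₁ : h ≡ t₁ ⊖ h → t₂ ≡ t₃
  triangle-fixed₁ h≡t₁-h = sym (begin
    t₃                              ≡⟨ solve (` t₃) (` t₁ ⊟ ` t₂ ⊞ ` t₃ ⊟ ` t₁ ⊞ ` t₂)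
                                             (ring (toℤ t₁) (toℤ t₂) (toℤ t₃)) ⟩
    (((t₁ ⊖ t₂) ⊕ t₃) ⊖ t₁) ⊕ t₂    ≡⟨ cong (λ z → (z ⊖ t₁) ⊕ t₂) (sym 2h≡t) ⟩
    ((h ⊕ h) ⊖ t₁) ⊕ t₂             ≡⟨ cong (λ z → ((h ⊕ z) ⊖ t₁) ⊕ t₂) h≡t₁-h ⟩
    ((h ⊕ (t₁ ⊖ h)) ⊖ t₁) ⊕ t₂      ≡⟨ cong (λ z → (z ⊖ t₁) ⊕ t₂) (⊕-⊖-inverse h t₁) ⟩
    (t₁ ⊖ t₁) ⊕ t₂                  ≡⟨ cong (_⊕ t₂) (⊖-self t₁) ⟩
    Fin.zero ⊕ t₂                   ≡⟨ solve (𝟘 ⊞ ` t₂) (` t₂) (ℤₚ.+-identityˡ (toℤ t₂)) ⟩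
    t₂                              ∎)
    where
    ring : ∀ t₁ t₂ t₃ → t₃ ≡ t₁ - t₂ + t₃ - t₁ + t₂
    ring = solve-∀

  triangle-fixed₂ : t₁ ⊖ h ≡ t₂ ⊖ (t₁ ⊖ h) → t₁ ≡ t₃
  triangle-fixed₂ v≡t₂-v = begin
    t₁                                          ≡⟨ solve (` t₁) (` t₁ ⊞ ` t₁ ⊟ (` t₁ ⊟ ` t₂ ⊞ ` t₃) ⊟ ` t₂ ⊞ ` t₃)
                                                         (ring (toℤ t₁) (toℤ t₂) (toℤ t₃)) ⟩
    (((t₁ ⊕ t₁) ⊖ ((t₁ ⊖ t₂) ⊕ t₃)) ⊖ t₂) ⊕ t₃  ≡⟨ cong (λ z → (((t₁ ⊕ t₁) ⊖ z) ⊖ t₂) ⊕ t₃) (sym 2h≡t) ⟩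
    (((t₁ ⊕ t₁) ⊖ (h ⊕ h)) ⊖ t₂) ⊕ t₃           ≡⟨ solve (` t₁ ⊞ ` t₁ ⊟ (` h ⊞ ` h) ⊟ ` t₂ ⊞ ` t₃)
                                                         (` t₁ ⊟ ` h ⊞ (` t₁ ⊟ ` h) ⊟ ` t₂ ⊞ ` t₃)
                                                         (ring′ (toℤ t₁) (toℤ h) (toℤ t₂) (toℤ t₃)) ⟩
    ((v ⊕ v) ⊖ t₂) ⊕ t₃                         ≡⟨ cong (λ z → ((v ⊕ z) ⊖ t₂) ⊕ t₃) v≡t₂-v ⟩
    ((v ⊕ (t₂ ⊖ v)) ⊖ t₂) ⊕ t₃                  ≡⟨ cong (λ z → (z ⊖ t₂) ⊕ t₃) (⊕-⊖-inverse v t₂) ⟩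
    (t₂ ⊖ t₂) ⊕ t₃                              ≡⟨ cong (_⊕ t₃) (⊖-self t₂) ⟩
    Fin.zero ⊕ t₃                               ≡⟨ solve (𝟘 ⊞ ` t₃) (` t₃) (ℤₚ.+-identityˡ (toℤ t₃)) ⟩
    t₃                                          ∎
    where
    v = t₁ ⊖ h
    ring : ∀ t₁ t₂ t₃ → t₁ ≡ t₁ + t₁ - (t₁ - t₂ + t₃) - t₂ + t₃
    ring = solve-∀
    ring′ : ∀ t₁ h t₂ t₃ → t₁ + t₁ - (h + h) - t₂ + t₃ ≡ t₁ - h + (t₁ - h) - t₂ + t₃
    ring′ = solve-∀

  triangle-closes : t₃ ⊖ (t₂ ⊖ (t₁ ⊖ h)) ≡ h
  triangle-closes = begin
    t₃ ⊖ (t₂ ⊖ (t₁ ⊖ h))   ≡⟨ solve (` t₃ ⊟ (` t₂ ⊟ (` t₁ ⊟ ` h))) (` t₁ ⊟ ` t₂ ⊞ ` t₃ ⊟ ` h)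
                                    (ring (toℤ t₁) (toℤ t₂) (toℤ t₃) (toℤ h)) ⟩
    ((t₁ ⊖ t₂) ⊕ t₃) ⊖ h   ≡⟨ cong (_⊖ h) (sym 2h≡t) ⟩
    (h ⊕ h) ⊖ h            ≡⟨ ⊕-⊖-cancelʳ h h ⟩
    h                      ∎
    where
    ring : ∀ t₁ t₂ t₃ h → t₃ - (t₂ - (t₁ - h)) ≡ t₁ - t₂ + t₃ - h
    ring = solve-∀

  triangle-fixed₃ : t₂ ⊖ (t₁ ⊖ h) ≡ h → t₁ ≡ t₂
  triangle-fixed₃ w≡h = sym (begin
    t₂                          ≡⟨ solve (` t₂) (` t₂ ⊟ (` t₁ ⊟ ` h) ⊞ ` t₁ ⊟ ` h) (ring (toℤ t₁) (toℤ t₂) (toℤ h)) ⟩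
    ((t₂ ⊖ (t₁ ⊖ h)) ⊕ t₁) ⊖ h  ≡⟨ cong (λ z → (z ⊕ t₁) ⊖ h) w≡h ⟩
    (h ⊕ t₁) ⊖ h                ≡⟨ ⊕-⊖-cancelˡ h t₁ ⟩
    t₁                          ∎)
    where
    ring : ∀ t₁ t₂ h → t₂ ≡ t₂ - (t₁ - h) + t₁ - h
    ring = solve-∀

module Constraints {m : ℕ} (U : Subset (suc m)) (c : Dih (suc m) → Bool) (avoids : Avoids c U) where

  private
    N = suc m

  ρ φ : Fin N → Bool
  ρ a = c (rot a)
  φ a = c (ref a)

  colours-differ : ∀ x y → x ≢ y → x · y ∈ U → c x ≢ c y
  colours-differ x y x≢y xy∈U cx≡cy = case trans (sym xy∈U) (avoids x y x≢y cx≡cy) of λ ()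

  ρ≢φ[s+a] : ∀ {s} → ref s ∈ U → ∀ a → ρ a ≢ φ (s ⊕ a)
  ρ≢φ[s+a] {s} fs∈U a =
    colours-differ (rot a) (ref (s ⊕ a)) (λ ()) (subst (λ z → ref z ∈ U) (sym (⊕-⊖-cancelʳ s a)) fs∈U)

  ρ≢φ[s-a] : ∀ {s} → ref s ∈ U → ∀ a → ρ a ≢ φ (s ⊖ a)
  ρ≢φ[s-a] {s} fs∈U a e =
    colours-differ (ref (s ⊖ a)) (rot a) (λ ()) (subst (λ z → ref z ∈ U) (sym (⊖-⊕-cancelʳ s a)) fs∈U) (sym e)

  ρ≢ρ[t-a] : ∀ {t} → rot t ∈ U → ∀ a → a ≢ t ⊖ a → ρ a ≢ ρ (t ⊖ a)
  ρ≢ρ[t-a] {t} rt∈U a a≢t-a =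
    colours-differ (rot a) (rot (t ⊖ a)) (a≢t-a ∘ rot-injective) (subst (λ z → rot z ∈ U) (sym (⊕-⊖-inverse a t)) rt∈U)

  φ-alternates : ∀ {t} → rot t ∈ U → t ≢ Fin.zero → Alternating φ t
  φ-alternates {t} rt∈U t≢0 a =
    colours-differ (ref a) (ref (a ⊕ t)) fa≢fa+t (subst (λ z → rot z ∈ U) (sym (⊕-⊖-cancelˡ a t)) rt∈U)
    where
    fa≢fa+t : ref a ≢ ref (a ⊕ t)
    fa≢fa+t e = t≢0 (trans (sym (⊕-⊖-cancelˡ a t)) (trans (cong (_⊖ a) (sym (ref-injective e))) (⊖-self a)))

  ρ-even : ∀ {s} → ref s ∈ U → ∀ x → ρ x ≡ ρ (neg x)
  ρ-even {s} fs∈U x = trans (¬-not (ρ≢φ[s+a] fs∈U x)) (sym (¬-not ρ[-x]≢φ[s+x]))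
    where
    ring : ∀ s x → s - (+ 0 - x) ≡ s + x
    ring = solve-∀
    ρ[-x]≢φ[s+x] : ρ (neg x) ≢ φ (s ⊕ x)
    ρ[-x]≢φ[s+x] = subst (λ z → ρ (neg x) ≢ φ z) (solve (` s ⊟ (𝟘 ⊟ ` x)) (` s ⊞ ` x) (ring (toℤ s) (toℤ x)))
                     (ρ≢φ[s-a] fs∈U (neg x))

  identity∉U : ∀ {s a : Fin N} → a ≢ neg a → ref s ∈ U → rot Fin.zero ∉ U
  identity∉U {a = a} a≢-a fs∈U e∈U = ρ≢ρ[t-a] e∈U a a≢-a (ρ-even fs∈U a)

  ρ-alternates : ∀ {s t} → ref s ∈ U → Alternating φ t → ∀ x → ρ (x ⊕ t) ≡ not (ρ x)
  ρ-alternates {s} {t} fs∈U φ-alt x = ¬-not (λ e → ρ≢φ[s+a] fs∈U (x ⊕ t) (trans e (sym φ[s+x+t]≡ρx)))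
    where
    ring : ∀ s x t → s + (x + t) ≡ s + x + t
    ring = solve-∀
    φ[s+x+t]≡ρx : φ (s ⊕ (x ⊕ t)) ≡ ρ x
    φ[s+x+t]≡ρx = begin
      φ (s ⊕ (x ⊕ t))      ≡⟨ cong φ (solve (` s ⊞ (` x ⊞ ` t)) (` s ⊞ ` x ⊞ ` t) (ring (toℤ s) (toℤ x) (toℤ t))) ⟩
      φ ((s ⊕ x) ⊕ t)      ≡⟨ ¬-not (φ-alt (s ⊕ x) ∘ sym) ⟩
      not (φ (s ⊕ x))      ≡⟨ cong not (¬-not (ρ≢φ[s+a] fs∈U x ∘ sym)) ⟩
      not (not (ρ x))      ≡⟨ not-involutive (ρ x) ⟩
      ρ x                  ∎
      where open ≡-Reasoning

  ρ-periodic : ∀ {s s'} → ref s ∈ U → ref s' ∈ U → ∀ x → ρ (x ⊕ (s ⊖ s')) ≡ ρ x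
  ρ-periodic {s} {s'} fs∈U fs'∈U x = trans (¬-not ρ[x+p]≢φ[s+x]) (sym (¬-not (ρ≢φ[s+a] fs∈U x)))
    where
    ring : ∀ s' x s → s' + (x + (s - s')) ≡ s + x
    ring = solve-∀
    ρ[x+p]≢φ[s+x] : ρ (x ⊕ (s ⊖ s')) ≢ φ (s ⊕ x)
    ρ[x+p]≢φ[s+x] = subst (λ z → ρ (x ⊕ (s ⊖ s')) ≢ φ z)
      (solve (` s' ⊞ (` x ⊞ (` s ⊟ ` s'))) (` s ⊞ ` x) (ring (toℤ s') (toℤ x) (toℤ s))) (ρ≢φ[s+a] fs'∈U (x ⊕ (s ⊖ s')))

  rotation≢double : ∀ {s t h a : Fin N} → a ≢ neg a → ref s ∈ U → rot t ∈ U → h ⊕ h ≢ t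
  rotation≢double {s} {t} {h} {a} a≢-a fs∈U rt∈U 2h≡t with t ≟ Fin.zero
  ... | yes refl = identity∉U {s} {a} a≢-a fs∈U rt∈U
  ... | no t≢0 = even-not-alternating-by-double {h = h} (ρ-even fs∈U) (ρ-alternates fs∈U (φ-alternates rt∈U t≢0)) 2h≡t

  rotation-shift≢double : ∀ {s s' t h} → ref s ∈ U → ref s' ∈ U → rot t ∈ U → t ≢ Fin.zero →
                          h ⊕ h ≢ t ⊖ (s ⊖ s')
  rotation-shift≢double {s} {s'} {t} {h} fs∈U fs'∈U rt∈U t≢0 =
    even-not-alternating-by-double {h = h} (ρ-even fs∈U) ρ-alternates-by-t-p
    where
    p = s ⊖ s'
    ring : ∀ x t p → x + (t - p) ≡ x - p + t
    ring = solve-∀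
    ρ-alternates-by-t-p : ∀ x → ρ (x ⊕ (t ⊖ p)) ≡ not (ρ x)
    ρ-alternates-by-t-p x = begin
      ρ (x ⊕ (t ⊖ p))        ≡⟨ cong ρ (solve (` x ⊞ (` t ⊟ ` p)) (` x ⊟ ` p ⊞ ` t) (ring (toℤ x) (toℤ t) (toℤ p))) ⟩
      ρ ((x ⊖ p) ⊕ t)        ≡⟨ ρ-alternates fs∈U (φ-alternates rt∈U t≢0) (x ⊖ p) ⟩
      not (ρ (x ⊖ p))        ≡⟨ cong not (sym (ρ-periodic fs∈U fs'∈U (x ⊖ p))) ⟩
      not (ρ ((x ⊖ p) ⊕ p))  ≡⟨ cong (not ∘ ρ) (⊖-⊕-cancelʳ x p) ⟩
      not (ρ x)              ∎
      where open ≡-Reasoning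

  -- With u = h, v = t₁ - u, w = t₂ - v we get t₃ - w = u, so the three rotations force
  -- ρ u ≠ ρ v ≠ ρ w ≠ ρ u, unless two of the t's coincide.
  three-rotations : ∀ {t₁ t₂ t₃ h} → rot t₁ ∈ U → rot t₂ ∈ U → rot t₃ ∈ U →
                    t₁ ≢ t₂ → t₂ ≢ t₃ → t₁ ≢ t₃ → h ⊕ h ≢ (t₁ ⊖ t₂) ⊕ t₃
  three-rotations {t₁} {t₂} {t₃} {h} rt₁∈U rt₂∈U rt₃∈U t₁≢t₂ t₂≢t₃ t₁≢t₃ 2h≡t =
    ρw≢ρu (sym (trans (¬-not ρu≢ρv) (trans (cong not (¬-not ρv≢ρw)) (not-involutive (ρ w)))))
    where
    open Triangle {m} {t₁} {t₂} {t₃} {h} 2h≡t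
    u v w : Fin N
    u = h
    v = t₁ ⊖ u
    w = t₂ ⊖ v
    ρu≢ρv : ρ u ≢ ρ v
    ρu≢ρv = ρ≢ρ[t-a] rt₁∈U u (t₂≢t₃ ∘ triangle-fixed₁)
    ρv≢ρw : ρ v ≢ ρ w
    ρv≢ρw = ρ≢ρ[t-a] rt₂∈U v (t₁≢t₃ ∘ triangle-fixed₂)
    ρw≢ρu : ρ w ≢ ρ u
    ρw≢ρu = subst (λ z → ρ w ≢ ρ z) triangle-closes
              (ρ≢ρ[t-a] rt₃∈U w (λ w≡t₃-w → t₁≢t₂ (triangle-fixed₃ (trans w≡t₃-w triangle-closes))))

-- Every avoidable set lies in a listed set

module _ {m : ℕ} where

  private
    N = suc m

  isEven-⟦⟧ : 2 ∣ N → ∀ {b} (x : Term) → ⟦ x ⟧ℤ ≡ parityℤ b mod 2 → isEven (toℕ ⟦ x ⟧) ≡ b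
  isEven-⟦⟧ 2∣N x p = isEven-from-mod (mod-trans (mod-∣-weaken 2∣N (⟦⟧-mod x)) p)

  halve : (t : Fin N) → isEven (toℕ t) ≡ true → ∃ λ h → 2 ℕ.* toℕ h ≡ toℕ t
  halve t t-even = fromℕ< h<N , trans (cong (2 ℕ.*_) (toℕ-fromℕ< h<N)) (m*[n/m]≡n (isEven⇒2∣ t-even))
    where h<N = ℕₚ.≤-<-trans (m/n≤m (toℕ t) 2) (toℕ<n t)

  dbl-mod : (k : Fin N) → toℤ (dbl k) ≡ + (2 ℕ.* toℕ k) mod N
  dbl-mod k = mod-trans (⊕-mod k k) (mod-reflexive (begin
    toℤ k + toℤ k            ≡⟨ sym (ℤₚ.pos-+ (toℕ k) (toℕ k)) ⟩
    + (toℕ k ℕ.+ toℕ k)      ≡⟨ cong (λ z → + (toℕ k ℕ.+ z)) (sym (ℕₚ.+-identityʳ (toℕ k))) ⟩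
    + (2 ℕ.* toℕ k)          ∎))
    where open ≡-Reasoning

  dbl-halve : ∀ (h t : Fin N) → 2 ℕ.* toℕ h ≡ toℕ t → dbl h ≡ t
  dbl-halve h t 2h≡t = toℤ-injective-mod (mod-trans (dbl-mod h) (mod-reflexive (cong +_ 2h≡t)))

  toℤ-parity : ∀ {b} (a : Fin N) → isEven (toℕ a) ≡ b → toℤ a ≡ parityℤ b mod 2
  toℤ-parity a refl = isEven-mod (toℕ a)

  order-of-half : 2 ∣ N → ∃ λ (k : Fin N) → 2 ∣ N div gcd N (toℕ k)
  order-of-half (divides q N≡q*2) = fromℕ< q<N , subst (2 ∣_) (sym N/gcd≡2) ∣-refl
    where
    instance
      q≢0 : NonZero q
      q≢0 = ℕ.≢-nonZero λ { refl → ℕₚ.1+n≢0 N≡q*2 }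
    q<N : q ℕ.< N
    q<N = subst (q ℕ.<_) (sym N≡q*2) (ℕₚ.m<m*n q 2 (s≤s (s≤s z≤n)))
    gcd≡q : gcd N (toℕ (fromℕ< q<N)) ≡ q
    gcd≡q = trans (cong (gcd N) (toℕ-fromℕ< q<N))
                  (GCD.unique (gcd-GCD N q) (GCD.is (divides 2 (trans N≡q*2 (ℕₚ.*-comm q 2)) , ∣-refl) proj₂))
    N/gcd≡2 : N div gcd N (toℕ (fromℕ< q<N)) ≡ 2
    N/gcd≡2 = begin
      N div gcd N (toℕ (fromℕ< q<N))   ≡⟨ cong (N div_) gcd≡q ⟩
      N div q                          ≡⟨ div≡/ N q ⟩
      N / q                            ≡⟨ cong (_/ q) (trans N≡q*2 (ℕₚ.*-comm q 2)) ⟩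
      2 ℕ.* q / q                      ≡⟨ m*n/n≡m 2 q ⟩
      2                                ∎
      where open ≡-Reasoning

data OddShape : Set where
  identity reflections : OddShape

odd-set : ∀ {n} → OddShape → Subset n
odd-set identity = setE
odd-set reflections = setF

data EvenShape (n : ℕ) : Set where
  identity-and : (k : Fin n) → 2 ∣ n div gcd n (toℕ k) → EvenShape n
  rotation-pair : (k l : Fin n) → 2 ∣ n div gcd n (2 ℕ.* toℕ k) → 2 ∣ n div gcd n (2 ℕ.* toℕ l) →
                  SameTwoMult (2 ℕ.* toℕ k) (2 ℕ.* toℕ l) → dbl k ≢ dbl l → EvenShape n
  A∪B A∪C B∪C : EvenShape n

even-set : ∀ {n} → EvenShape n → Subset n
even-set (identity-and k _) = setEk k
even-set (rotation-pair k l _ _ _ _) = setPair (dbl k) (dbl l)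
even-set A∪B = setA ∪ setB
even-set A∪C = setA ∪ setC
even-set B∪C = setB ∪ setC

eqFin-refl : ∀ {n} (a : Fin n) → eqFin a a ≡ true
eqFin-refl Fin.zero = refl
eqFin-refl (Fin.suc a) = eqFin-refl a

eqFin-true : ∀ {n} {a b : Fin n} → eqFin a b ≡ true → a ≡ b
eqFin-true {a = Fin.zero} {Fin.zero} _ = refl
eqFin-true {a = Fin.suc a} {Fin.suc b} e = cong Fin.suc (eqFin-true {a = a} {b} e)

∈setEk-zero : ∀ {n} (k : Fin (suc n)) → setEk k (rot Fin.zero) ≡ true
∈setEk-zero k = refl

∈setEk-k : ∀ {n} (k : Fin n) → setEk k (rot k) ≡ true
∈setEk-k k = trans (cong (isZero (toℕ k) ∨_) (eqFin-refl k)) (∨-zeroʳ (isZero (toℕ k)))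

∈setPair-left : ∀ {n} (a b : Fin n) → setPair a b (rot a) ≡ true
∈setPair-left a b = cong (_∨ eqFin a b) (eqFin-refl a)

∈setPair-right : ∀ {n} (a b : Fin n) → setPair a b (rot b) ≡ true
∈setPair-right a b = trans (cong (eqFin b a ∨_) (eqFin-refl b)) (∨-zeroʳ (eqFin b a))

module Classification {m : ℕ} (a₁ : Fin (suc m)) (a₁≢-a₁ : a₁ ≢ neg a₁)
                      (U : Subset (suc m)) (c : Dih (suc m) → Bool) (avoids : Avoids c U) where

  open Constraints U c avoids

  private
    N = suc m

  rotations-only : ∀ {V : Subset N} → (∀ s → ref s ∉ U) → (∀ a → rot a ∈ U → rot a ∈ V) → U ⊆ V
  rotations-only ∄ref rot⊆V (rot a) ra∈U = rot⊆V a ra∈U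
  rotations-only ∄ref rot⊆V (ref s) fs∈U = ⊥-elim (∄ref s fs∈U)

  odd-classification : ¬ 2 ∣ N → ∃ λ i → U ⊆ odd-set i
  odd-classification N-odd with any? (λ s → U (ref s) Bool.≟ true)
  ... | yes (s , fs∈U) = reflections , ⊆setF
    where
    ⊆setF : U ⊆ setF
    ⊆setF (rot a) ra∈U with a ≟ Fin.zero
    ... | yes refl = ⊥-elim (identity∉U a₁≢-a₁ fs∈U ra∈U)
    ... | no a≢0 = ⊥-elim (N-odd (alternating⇒2∣N (φ-alternates ra∈U a≢0)))
    ⊆setF (ref a) _ = refl
  ... | no ∄ref = identity , rotations-only (λ s fs∈U → ∄ref (s , fs∈U)) rot⊆setE
    where
    rot⊆setE : ∀ a → rot a ∈ U → rot a ∈ setE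
    rot⊆setE a ra∈U with a ≟ Fin.zero
    ... | yes refl = refl
    ... | no a≢0 = ⊥-elim (N-odd (alternating⇒2∣N (φ-alternates ra∈U a≢0)))

  module _ (2∣N : 2 ∣ N) where

    rotation-odd : ∀ {s t} → ref s ∈ U → rot t ∈ U → isEven (toℕ t) ≡ false
    rotation-odd {t = t} fs∈U rt∈U with isEven (toℕ t) in t-even
    ... | false = refl
    ... | true with halve t t-even
    ...   | h , 2h≡t = ⊥-elim (rotation≢double {h = h} a₁≢-a₁ fs∈U rt∈U (dbl-halve h t 2h≡t))

    reflections-same-parity : ∀ {s s' t} → ref s ∈ U → ref s' ∈ U → rot t ∈ U → isEven (toℕ s) ≡ isEven (toℕ s')
    reflections-same-parity {s} {s'} {t} fs∈U fs'∈U rt∈U = parityℤ-injective-mod (begin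
      parityℤ (isEven (toℕ s))                    ≈⟨ mod-sym (isEven-mod (toℕ s)) ⟩
      toℤ s                                       ≡⟨ ring (toℤ s) (toℤ s') (toℤ t) ⟩
      toℤ s' + (toℤ t - (toℤ t - (toℤ s - toℤ s'))) ≈⟨ +-cong-mod (isEven-mod (toℕ s'))
                                                        (minus-cong-mod (toℤ-parity t t-odd) shift-odd) ⟩
      parityℤ (isEven (toℕ s')) + (+ 1 - + 1)      ≡⟨ ℤₚ.+-identityʳ _ ⟩
      parityℤ (isEven (toℕ s'))                   ∎)
      where
      open ≡-mod-Reasoning 2
      ring : ∀ s s' t → s ≡ s' + (t - (t - (s - s')))
      ring = solve-∀
      t-odd = rotation-odd fs∈U rt∈U
      shift-odd : toℤ t - (toℤ s - toℤ s') ≡ + 1 mod 2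
      shift-odd with isEven (toℕ (t ⊖ (s ⊖ s'))) in shift-even
      ... | true = ⊥-elim (rotation-shift≢double {h = h} fs∈U fs'∈U rt∈U t≢0 (dbl-halve h (t ⊖ (s ⊖ s')) 2h≡shift))
        where
        h = proj₁ (halve (t ⊖ (s ⊖ s')) shift-even)
        2h≡shift = proj₂ (halve (t ⊖ (s ⊖ s')) shift-even)
        t≢0 : t ≢ Fin.zero
        t≢0 refl = case t-odd of λ ()
      ... | false = mod-trans (mod-sym (mod-∣-weaken 2∣N (⟦⟧-mod (` t ⊟ (` s ⊟ ` s')))))
                              (toℤ-parity (t ⊖ (s ⊖ s')) shift-even)

    rotations-same-parity : ∀ {t t'} → rot t ∈ U → rot t' ∈ U → t ≢ Fin.zero → t' ≢ Fin.zero →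
                            isEven (toℕ t) ≡ isEven (toℕ t')
    rotations-same-parity rt∈U rt'∈U t≢0 t'≢0 =
      isEven-cong (alternating-2-valuation (φ-alternates rt∈U t≢0) (φ-alternates rt'∈U t'≢0) 1)
                  (alternating-2-valuation (φ-alternates rt'∈U t'≢0) (φ-alternates rt∈U t≢0) 1)

    -- Nonzero rotations in U share their parity, and a zero one is even like t.
    same-parity-beside-even : ∀ {t t' a} → isEven (toℕ t) ≡ true → rot t ∈ U → rot t' ∈ U → rot a ∈ U →
                              t' ≢ t → a ≢ t → a ≢ t' → isEven (toℕ t') ≡ isEven (toℕ a)
    same-parity-beside-even {t} {t'} {a} t-even rt∈U rt'∈U ra∈U t'≢t a≢t a≢t' with t' ≟ Fin.zero | a ≟ Fin.zero
    ... | yes refl | yes refl = ⊥-elim (a≢t' refl)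
    ... | yes refl | no a≢0 = trans (sym t-even) (rotations-same-parity rt∈U ra∈U (t'≢t ∘ sym) a≢0)
    ... | no t'≢0 | yes refl = trans (sym (rotations-same-parity rt∈U rt'∈U (a≢t ∘ sym) t'≢0)) t-even
    ... | no t'≢0 | no a≢0 = rotations-same-parity rt'∈U ra∈U t'≢0 a≢0

    no-third-rotation : ∀ {t t' a} → isEven (toℕ t) ≡ true → rot t ∈ U → rot t' ∈ U → rot a ∈ U →
                        t' ≢ t → a ≢ t → a ≢ t' → ⊥
    no-third-rotation {t} {t'} {a} t-even rt∈U rt'∈U ra∈U t'≢t a≢t a≢t' =
      three-rotations {h = h} rt∈U rt'∈U ra∈U (t'≢t ∘ sym) (a≢t' ∘ sym) (a≢t ∘ sym)
        (dbl-halve h ((t ⊖ t') ⊕ a) 2h≡t-t'+a)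
      where
      open ≡-mod-Reasoning 2
      ring : ∀ p → + 0 - p + p ≡ + 0
      ring = solve-∀
      parity-t'≡parity-a = same-parity-beside-even t-even rt∈U rt'∈U ra∈U t'≢t a≢t a≢t'
      t-t'+a-even : isEven (toℕ ((t ⊖ t') ⊕ a)) ≡ true
      t-t'+a-even = isEven-⟦⟧ 2∣N (` t ⊟ ` t' ⊞ ` a) (begin
        toℤ t - toℤ t' + toℤ a                     ≈⟨ +-cong-mod (minus-cong-mod (toℤ-parity t t-even) (isEven-mod (toℕ t')))
                                                                     (toℤ-parity a (sym parity-t'≡parity-a)) ⟩
        + 0 - parityℤ (isEven (toℕ t')) + parityℤ (isEven (toℕ t'))  ≡⟨ ring (parityℤ (isEven (toℕ t'))) ⟩
        + 0                                        ∎)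
      h = proj₁ (halve ((t ⊖ t') ⊕ a) t-t'+a-even)
      2h≡t-t'+a = proj₂ (halve ((t ⊖ t') ⊕ a) t-t'+a-even)

    with-reflection : ∀ {s} → ref s ∈ U → ∃ λ i → U ⊆ even-set i
    with-reflection {s} fs∈U with any? (λ t → U (rot t) Bool.≟ true)
    ... | no ∄rot = B∪C , ⊆B∪C
      where
      ⊆B∪C : U ⊆ (setB ∪ setC)
      ⊆B∪C (rot a) ra∈U = ⊥-elim (∄rot (a , ra∈U))
      ⊆B∪C (ref a) _ = ∨-inverseʳ (isEven (toℕ a))
    ... | yes (t , rt∈U) with isEven (toℕ s) in s-even
    ...   | true = A∪B , ⊆A∪B
      where
      ⊆A∪B : U ⊆ (setA ∪ setB)
      ⊆A∪B (rot a) ra∈U = cong (λ b → not b ∨ false) (rotation-odd fs∈U ra∈U)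
      ⊆A∪B (ref a) fa∈U = trans (sym (reflections-same-parity fs∈U fa∈U rt∈U)) s-even
    ...   | false = A∪C , ⊆A∪C
      where
      ⊆A∪C : U ⊆ (setA ∪ setC)
      ⊆A∪C (rot a) ra∈U = cong (λ b → not b ∨ false) (rotation-odd fs∈U ra∈U)
      ⊆A∪C (ref a) fa∈U = cong not (trans (sym (reflections-same-parity fs∈U fa∈U rt∈U)) s-even)

    single-rotation : ∀ {t} → (∀ s → ref s ∉ U) → rot t ∈ U → (∀ a → rot a ∈ U → a ≡ t) →
                        ∃ λ i → U ⊆ even-set i
    single-rotation {t} ∄ref rt∈U only-t with t ≟ Fin.zero
    ... | yes refl = identity-and k k-order ,
                     rotations-only ∄ref (λ a ra∈U → rot∈-resp (setEk k) (sym (only-t a ra∈U)) (∈setEk-zero k))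
      where
      k = proj₁ (order-of-half 2∣N)
      k-order = proj₂ (order-of-half 2∣N)
    ... | no t≢0 = identity-and t (alternating⇒even-order (φ-alternates rt∈U t≢0)) ,
                   rotations-only ∄ref (λ a ra∈U → rot∈-resp (setEk t) (sym (only-t a ra∈U)) (∈setEk-k t))

    rotation-pair-shape : ∀ {t t'} → isEven (toℕ t) ≡ true → rot t ∈ U → rot t' ∈ U →
                          t ≢ Fin.zero → t' ≢ Fin.zero → t' ≢ t → ∃ λ i → rot t ∈ even-set i × rot t' ∈ even-set i
    rotation-pair-shape {t} {t'} t-even rt∈U rt'∈U t≢0 t'≢0 t'≢t =
      rotation-pair k l k-order l-order same-2-valuation 2k≢2l ,
      rot∈-resp (setPair (dbl k) (dbl l)) (dbl-halve k t 2k≡t) (∈setPair-left (dbl k) (dbl l)) ,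
      rot∈-resp (setPair (dbl k) (dbl l)) (dbl-halve l t' 2l≡t') (∈setPair-right (dbl k) (dbl l))
      where
      alt = φ-alternates rt∈U t≢0
      alt' = φ-alternates rt'∈U t'≢0
      t'-even = trans (sym (rotations-same-parity rt∈U rt'∈U t≢0 t'≢0)) t-even
      k = proj₁ (halve t t-even)
      l = proj₁ (halve t' t'-even)
      2k≡t = proj₂ (halve t t-even)
      2l≡t' = proj₂ (halve t' t'-even)
      k-order : 2 ∣ N div gcd N (2 ℕ.* toℕ k)
      k-order = subst (λ z → 2 ∣ N div gcd N z) (sym 2k≡t) (alternating⇒even-order alt)
      l-order : 2 ∣ N div gcd N (2 ℕ.* toℕ l)
      l-order = subst (λ z → 2 ∣ N div gcd N z) (sym 2l≡t') (alternating⇒even-order alt')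
      same-2-valuation : SameTwoMult (2 ℕ.* toℕ k) (2 ℕ.* toℕ l)
      same-2-valuation i =
        (λ 2ⁱ∣2k → subst (2 ^ i ∣_) (sym 2l≡t') (alternating-2-valuation alt alt' i (subst (2 ^ i ∣_) 2k≡t 2ⁱ∣2k))) ,
        (λ 2ⁱ∣2l → subst (2 ^ i ∣_) (sym 2k≡t) (alternating-2-valuation alt' alt i (subst (2 ^ i ∣_) 2l≡t' 2ⁱ∣2l)))
      2k≢2l : dbl k ≢ dbl l
      2k≢2l e = t'≢t (trans (sym (dbl-halve l t' 2l≡t')) (trans (sym e) (dbl-halve k t 2k≡t)))

    two-rotations : ∀ {t t'} → (∀ s → ref s ∉ U) → isEven (toℕ t) ≡ true → rot t ∈ U → rot t' ∈ U → t' ≢ t →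
                         (∀ a → rot a ∈ U → a ≡ t ⊎ a ≡ t') → ∃ λ i → U ⊆ even-set i
    two-rotations {t} {t'} ∄ref t-even rt∈U rt'∈U t'≢t only-t-t' with t ≟ Fin.zero | t' ≟ Fin.zero
    ... | yes refl | yes refl = ⊥-elim (t'≢t refl)
    ... | yes refl | no t'≢0 =
      identity-and t' (alternating⇒even-order (φ-alternates rt'∈U t'≢0)) , rotations-only ∄ref ⊆setEk
      where
      ⊆setEk : ∀ a → rot a ∈ U → rot a ∈ setEk t'
      ⊆setEk a ra∈U with only-t-t' a ra∈U
      ... | inj₁ refl = ∈setEk-zero t'
      ... | inj₂ refl = ∈setEk-k t'
    ... | no t≢0 | yes refl =
      identity-and t (alternating⇒even-order (φ-alternates rt∈U t≢0)) , rotations-only ∄ref ⊆setEk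
      where
      ⊆setEk : ∀ a → rot a ∈ U → rot a ∈ setEk t
      ⊆setEk a ra∈U with only-t-t' a ra∈U
      ... | inj₁ refl = ∈setEk-k t
      ... | inj₂ refl = ∈setEk-zero t
    ... | no t≢0 | no t'≢0 = proj₁ shape , rotations-only ∄ref ⊆shape
      where
      shape = rotation-pair-shape t-even rt∈U rt'∈U t≢0 t'≢0 t'≢t
      ⊆shape : ∀ a → rot a ∈ U → rot a ∈ even-set (proj₁ shape)
      ⊆shape a ra∈U with only-t-t' a ra∈U
      ... | inj₁ refl = proj₁ (proj₂ shape)
      ... | inj₂ refl = proj₂ (proj₂ shape)

    without-reflection : (∀ s → ref s ∉ U) → ∃ λ i → U ⊆ even-set i
    without-reflection ∄ref
      with any? (λ t → (isEven (toℕ t) Bool.≟ true) ×-dec (U (rot t) Bool.≟ true))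
    ... | no ∄even = A∪B , rotations-only ∄ref rot⊆A
      where
      rot⊆A : ∀ a → rot a ∈ U → rot a ∈ (setA ∪ setB)
      rot⊆A a ra∈U with isEven (toℕ a) in a-even
      ... | true = ⊥-elim (∄even (a , a-even , ra∈U))
      ... | false = refl
    ... | yes (t , t-even , rt∈U) with any? (λ t' → ¬? (t' ≟ t) ×-dec (U (rot t') Bool.≟ true))
    ...   | no ∄other = single-rotation ∄ref rt∈U only-t
      where
      only-t : ∀ a → rot a ∈ U → a ≡ t
      only-t a ra∈U with a ≟ t
      ... | yes a≡t = a≡t
      ... | no a≢t = ⊥-elim (∄other (a , a≢t , ra∈U))
    ...   | yes (t' , t'≢t , rt'∈U) = two-rotations ∄ref t-even rt∈U rt'∈U t'≢t only-t-t'
      where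
      only-t-t' : ∀ a → rot a ∈ U → a ≡ t ⊎ a ≡ t'
      only-t-t' a ra∈U with a ≟ t | a ≟ t'
      ... | yes a≡t | _ = inj₁ a≡t
      ... | no _ | yes a≡t' = inj₂ a≡t'
      ... | no a≢t | no a≢t' = ⊥-elim (no-third-rotation t-even rt∈U rt'∈U ra∈U t'≢t a≢t a≢t')

    even-classification : ∃ λ i → U ⊆ even-set i
    even-classification with any? (λ s → U (ref s) Bool.≟ true)
    ... | yes (s , fs∈U) = with-reflection fs∈U
    ... | no ∄ref = without-reflection (λ s fs∈U → ∄ref (s , fs∈U))

-- The listed sets are avoidable

does-≟-≡ : ∀ {x y} → x ≡ y → does (x Bool.≟ y) ≡ true
does-≟-≡ {x} {y} = dec-true (x Bool.≟ y)

does-≟-not : ∀ {x y} → y ≡ not x → does (x Bool.≟ y) ≡ false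
does-≟-not {x} {y} y≡¬x = dec-false (x Bool.≟ y) (λ x≡y → not-¬ (sym x≡y) y≡¬x)

nonconstant-avoids⇒avoidable : ∀ {n} {U : Subset n} (c : Dih n → Bool) {x y} → c x ≢ c y → Avoids c U →
                               Avoidable U
nonconstant-avoids⇒avoidable c {x} {y} cx≢cy avoids with c x in cx | c y in cy
... | true | false = c , (x , cx) , (y , cy) , avoids
... | false | true = c , (y , cy) , (x , cx) , avoids
... | true | true = ⊥-elim (cx≢cy refl)
... | false | false = ⊥-elim (cx≢cy refl)

rotations-vs-reflections : ∀ {n} → Dih n → Bool
rotations-vs-reflections (rot _) = true
rotations-vs-reflections (ref _) = false

reflections-only-avoidable : ∀ {n} {U : Subset (suc n)} → (∀ a → U (rot a) ≡ false) → Avoidable U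
reflections-only-avoidable {U = U} rot∉U =
  nonconstant-avoids⇒avoidable {U = U} rotations-vs-reflections {rot Fin.zero} {ref Fin.zero} (λ ()) avoids
  where
  avoids : Avoids rotations-vs-reflections U
  avoids (rot a) (rot b) _ _ = rot∉U (a ⊕ b)
  avoids (rot a) (ref b) _ ()
  avoids (ref a) (rot b) _ ()
  avoids (ref a) (ref b) _ _ = rot∉U (b ⊖ a)

module _ {m : ℕ} where

  private
    N = suc m

  paint : (Fin N → Bool) → (Fin N → Bool) → Dih N → Bool
  paint ρ φ (rot a) = ρ a
  paint ρ φ (ref a) = φ a

  paint-avoids : ∀ {U : Subset N} {ρ φ} → (∀ s → U (ref s) ≡ false) →
                 (∀ a b → a ≢ b → ρ a ≡ ρ b → U (rot (a ⊕ b)) ≡ false) →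
                 (∀ a b → a ≢ b → φ a ≡ φ b → U (rot (b ⊖ a)) ≡ false) → Avoids (paint ρ φ) U
  paint-avoids ref∉U ρ-ok φ-ok (rot a) (rot b) ra≢rb = ρ-ok a b (ra≢rb ∘ cong rot)
  paint-avoids ref∉U ρ-ok φ-ok (rot a) (ref b) _ _ = ref∉U (b ⊖ a)
  paint-avoids ref∉U ρ-ok φ-ok (ref a) (rot b) _ _ = ref∉U (a ⊕ b)
  paint-avoids ref∉U ρ-ok φ-ok (ref a) (ref b) fa≢fb = φ-ok a b (fa≢fb ∘ cong ref)

  ⊕≡⇒≡⊖ : ∀ {a b t : Fin N} → a ⊕ b ≡ t → b ≡ t ⊖ a
  ⊕≡⇒≡⊖ {a} {b} refl = sym (⊕-⊖-cancelˡ a b)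

  ⊖≡⇒≡⊕ : ∀ {a b t : Fin N} → b ⊖ a ≡ t → b ≡ a ⊕ t
  ⊖≡⇒≡⊕ {a} {b} refl = sym (⊕-⊖-inverse a b)

  isZero-nonzero : ∀ {a : Fin N} → a ≢ Fin.zero → isZero (toℕ a) ≡ false
  isZero-nonzero {Fin.zero} a≢0 = ⊥-elim (a≢0 refl)
  isZero-nonzero {Fin.suc a} _ = refl

  eqFin-false : ∀ {a b : Fin N} → a ≢ b → eqFin a b ≡ false
  eqFin-false {a} {b} a≢b with eqFin a b in e
  ... | true = ⊥-elim (a≢b (eqFin-true e))
  ... | false = refl

  ⊖-nonzero : ∀ {a b : Fin N} → a ≢ b → b ⊖ a ≢ Fin.zero
  ⊖-nonzero {a} {b} a≢b b-a≡0 = a≢b (sym (trans (⊖≡⇒≡⊕ {a} {b} b-a≡0) (solve (` a ⊞ 𝟘) (` a) (ℤₚ.+-identityʳ (toℤ a)))))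

  sum≢ : ∀ {ρ : Fin N → Bool} {t} → (∀ a → a ≢ t ⊖ a → ρ a ≢ ρ (t ⊖ a)) →
         ∀ a b → a ≢ b → ρ a ≡ ρ b → a ⊕ b ≢ t
  sum≢ {ρ} separates a b a≢b ρa≡ρb a+b≡t =
    separates a (λ a≡t-a → a≢b (trans a≡t-a (sym b≡t-a))) (trans ρa≡ρb (cong ρ b≡t-a))
    where b≡t-a = ⊕≡⇒≡⊖ {a} {b} a+b≡t

  setE-avoidable : ∀ {a₁ : Fin N} → a₁ ≢ neg a₁ → Avoidable {N} setE
  setE-avoidable {a₁} a₁≢-a₁ = nonconstant-avoids⇒avoidable {U = setE} (paint ρ (const false)) {rot a₁} {rot (neg a₁)}
    (separates a₁ a₁≢-a₁) (paint-avoids {U = setE} (λ _ → refl) ρ-ok (λ a b a≢b _ → isZero-nonzero (⊖-nonzero a≢b)))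
    where
    colouring = two-reflection-colouring {m} Fin.zero
    ρ = proj₁ colouring
    separates = proj₁ (proj₂ colouring)
    ρ-ok : ∀ a b → a ≢ b → ρ a ≡ ρ b → setE (rot (a ⊕ b)) ≡ false
    ρ-ok a b a≢b ρa≡ρb = isZero-nonzero (sum≢ separates a b a≢b ρa≡ρb)

  module _ (2∣N : 2 ∣ N) where

    private
      parity : Fin N → Bool
      parity a = isEven (toℕ a)

    isEven-⊕ : ∀ a b → parity (a ⊕ b) ≡ does (parity a Bool.≟ parity b)
    isEven-⊕ a b = isEven-⟦⟧ 2∣N (` a ⊞ ` b)
      (mod-trans (+-cong-mod (isEven-mod (toℕ a)) (isEven-mod (toℕ b))) (parityℤ-+ (parity a) (parity b)))
      where
      parityℤ-+ : ∀ x y → parityℤ x + parityℤ y ≡ parityℤ (does (x Bool.≟ y)) mod 2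
      parityℤ-+ true true = mod-refl
      parityℤ-+ true false = mod-refl
      parityℤ-+ false true = mod-refl
      parityℤ-+ false false = mkMod (+ 1) refl

    isEven-⊖ : ∀ a b → parity (a ⊖ b) ≡ does (parity a Bool.≟ parity b)
    isEven-⊖ a b = isEven-⟦⟧ 2∣N (` a ⊟ ` b)
      (mod-trans (minus-cong-mod (isEven-mod (toℕ a)) (isEven-mod (toℕ b))) (parityℤ-- (parity a) (parity b)))
      where
      parityℤ-- : ∀ x y → parityℤ x - parityℤ y ≡ parityℤ (does (x Bool.≟ y)) mod 2
      parityℤ-- true true = mod-refl
      parityℤ-- true false = mkMod -[1+ 0 ] refl
      parityℤ-- false true = mod-refl
      parityℤ-- false false = mod-refl

    A∪B-avoidable : Avoidable {N} (setA ∪ setB)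
    A∪B-avoidable = nonconstant-avoids⇒avoidable {U = setA ∪ setB} c {rot Fin.zero} {ref Fin.zero} (λ ()) avoids
      where
      c : Dih N → Bool
      c = paint parity (not ∘ parity)
      avoids : Avoids c (setA ∪ setB)
      avoids (rot a) (rot b) _ e = cong (λ z → not z ∨ false) (trans (isEven-⊕ a b) (does-≟-≡ e))
      avoids (rot a) (ref b) _ e = trans (isEven-⊖ b a) (does-≟-not e)
      avoids (ref a) (rot b) _ e = trans (isEven-⊕ a b) (does-≟-not (sym e))
      avoids (ref a) (ref b) _ e = cong (λ z → not z ∨ false) (trans (isEven-⊖ b a) (does-≟-≡ (sym (not-injective e))))

    A∪C-avoidable : ∀ {o} → isEven (toℕ o) ≡ false → Avoidable {N} (setA ∪ setC)
    A∪C-avoidable {o} o-odd = nonconstant-avoids⇒avoidable {U = setA ∪ setC} c {rot Fin.zero} {rot o}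
      (λ e → case trans e o-odd of λ ()) avoids
      where
      c : Dih N → Bool
      c = paint parity parity
      avoids : Avoids c (setA ∪ setC)
      avoids (rot a) (rot b) _ e = cong (λ z → not z ∨ false) (trans (isEven-⊕ a b) (does-≟-≡ e))
      avoids (rot a) (ref b) _ e = cong not (trans (isEven-⊖ b a) (does-≟-≡ (sym e)))
      avoids (ref a) (rot b) _ e = cong not (trans (isEven-⊕ a b) (does-≟-≡ e))
      avoids (ref a) (ref b) _ e = cong (λ z → not z ∨ false) (trans (isEven-⊖ b a) (does-≟-≡ (sym e)))

  difference≢ : ∀ {φ : Fin N → Bool} {t} → (∀ a → φ (a ⊕ t) ≢ φ a) → ∀ a b → φ a ≡ φ b → b ⊖ a ≢ t
  difference≢ {φ} flips a b φa≡φb b-a≡t = flips a (trans (cong φ (sym (⊖≡⇒≡⊕ {a} {b} b-a≡t))) (sym φa≡φb))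

  bit-alternates : ∀ j {T} (t : Fin N) → toℤ t ≡ + T mod N → 2 ^ j ∣ T → ¬ 2 ^ suc j ∣ T → 2 ^ suc j ∣ N →
                   ∀ a → bit j (toℕ (a ⊕ t)) ≢ bit j (toℕ a)
  bit-alternates j {T} t t≡T 2ʲ∣T 2ʲ⁺¹∤T 2ʲ⁺¹∣N a e =
    not-¬ refl (trans (sym e) (bit-flip {N} {j} {T} {toℕ a} {toℕ (a ⊕ t)} 2ʲ∣T 2ʲ⁺¹∤T 2ʲ⁺¹∣N
      (mod-trans (⊕-mod a t) (+-cong-mod (mod-refl {a = toℤ a}) t≡T))))

  setEk-avoidable : ∀ k → 2 ∣ N div gcd N (toℕ k) → Avoidable {N} (setEk k)
  setEk-avoidable k k-order with even-order⇒2-valuation< N (toℕ k) k-order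
  ... | j , 2ʲ∣k , 2ʲ⁺¹∤k , 2ʲ⁺¹∣N =
    nonconstant-avoids⇒avoidable {U = setEk k} (paint ρ φ) {ref (Fin.zero ⊕ k)} {ref Fin.zero}
    (flips Fin.zero) (paint-avoids {U = setEk k} (λ _ → refl) ρ-ok φ-ok)
    where
    φ : Fin N → Bool
    φ x = bit j (toℕ x)
    flips : ∀ a → φ (a ⊕ k) ≢ φ a
    flips = bit-alternates j k mod-refl 2ʲ∣k 2ʲ⁺¹∤k 2ʲ⁺¹∣N
    colouring = two-reflection-colouring k
    ρ = proj₁ colouring
    ρ-ok : ∀ a b → a ≢ b → ρ a ≡ ρ b → setEk k (rot (a ⊕ b)) ≡ false
    ρ-ok a b a≢b ρa≡ρb = cong₂ _∨_ (isZero-nonzero (sum≢ (proj₁ (proj₂ colouring)) a b a≢b ρa≡ρb))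
                                   (eqFin-false (sum≢ (proj₂ (proj₂ colouring)) a b a≢b ρa≡ρb))
    φ-ok : ∀ a b → a ≢ b → φ a ≡ φ b → setEk k (rot (b ⊖ a)) ≡ false
    φ-ok a b a≢b φa≡φb = cong₂ _∨_ (isZero-nonzero (⊖-nonzero a≢b))
                                   (eqFin-false (difference≢ flips a b φa≡φb))

  shifted-separation : ∀ {ρ₀ : Fin N → Bool} {t k T} → t ⊕ dbl k ≡ T → (∀ x → x ≢ t ⊖ x → ρ₀ x ≢ ρ₀ (t ⊖ x)) →
                       ∀ a → a ≢ T ⊖ a → ρ₀ (a ⊖ k) ≢ ρ₀ ((T ⊖ a) ⊖ k)
  shifted-separation {ρ₀} {t} {k} refl separates a a≢T-a =
    subst (λ z → ρ₀ (a ⊖ k) ≢ ρ₀ z) t-[a-k]≡T-a-k (separates (a ⊖ k) (λ e → a≢T-a (cancel (trans e t-[a-k]≡T-a-k))))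
    where
    ring : ∀ t k a → t - (a - k) ≡ t + (k + k) - a - k
    ring = solve-∀
    t-[a-k]≡T-a-k : t ⊖ (a ⊖ k) ≡ ((t ⊕ dbl k) ⊖ a) ⊖ k
    t-[a-k]≡T-a-k = solve (` t ⊟ (` a ⊟ ` k)) (` t ⊞ (` k ⊞ ` k) ⊟ ` a ⊟ ` k) (ring (toℤ t) (toℤ k) (toℤ a))
    cancel : ∀ {x y} → x ⊖ k ≡ y ⊖ k → x ≡ y
    cancel {x} {y} e = trans (sym (⊖-⊕-cancelʳ x k)) (trans (cong (_⊕ k) e) (⊖-⊕-cancelʳ y k))

  setPair-avoidable : ∀ k l → 2 ∣ N div gcd N (2 ℕ.* toℕ k) → SameTwoMult (2 ℕ.* toℕ k) (2 ℕ.* toℕ l) →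
                      Avoidable {N} (setPair (dbl k) (dbl l))
  setPair-avoidable k l k-order same-2-valuation with even-order⇒2-valuation< N (2 ℕ.* toℕ k) k-order
  ... | j , 2ʲ∣2k , 2ʲ⁺¹∤2k , 2ʲ⁺¹∣N =
    nonconstant-avoids⇒avoidable {U = setPair (dbl k) (dbl l)} (paint ρ φ) {ref (Fin.zero ⊕ dbl k)} {ref Fin.zero}
      (flips-k Fin.zero) (paint-avoids {U = setPair (dbl k) (dbl l)} (λ _ → refl) ρ-ok φ-ok)
    where
    φ : Fin N → Bool
    φ x = bit j (toℕ x)
    flips-k : ∀ a → φ (a ⊕ dbl k) ≢ φ a
    flips-k = bit-alternates j (dbl k) (dbl-mod k) 2ʲ∣2k 2ʲ⁺¹∤2k 2ʲ⁺¹∣N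
    flips-l : ∀ a → φ (a ⊕ dbl l) ≢ φ a
    flips-l = bit-alternates j (dbl l) (dbl-mod l) (proj₁ (same-2-valuation j) 2ʲ∣2k)
                (2ʲ⁺¹∤2k ∘ proj₂ (same-2-valuation (suc j))) 2ʲ⁺¹∣N
    d = dbl l ⊖ dbl k
    colouring = two-reflection-colouring d
    ρ : Fin N → Bool
    ρ a = proj₁ colouring (a ⊖ k)
    separates-2k = shifted-separation {t = Fin.zero} {k}
                     (solve (𝟘 ⊞ (` k ⊞ ` k)) (` k ⊞ ` k) (ℤₚ.+-identityˡ (toℤ k + toℤ k))) (proj₁ (proj₂ colouring))
    separates-2l = shifted-separation {t = d} {k} (⊖-⊕-cancelʳ (dbl l) (dbl k)) (proj₂ (proj₂ colouring))
    ρ-ok : ∀ a b → a ≢ b → ρ a ≡ ρ b → setPair (dbl k) (dbl l) (rot (a ⊕ b)) ≡ false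
    ρ-ok a b a≢b ρa≡ρb = cong₂ _∨_ (eqFin-false (sum≢ separates-2k a b a≢b ρa≡ρb))
                                   (eqFin-false (sum≢ separates-2l a b a≢b ρa≡ρb))
    φ-ok : ∀ a b → a ≢ b → φ a ≡ φ b → setPair (dbl k) (dbl l) (rot (b ⊖ a)) ≡ false
    φ-ok a b a≢b φa≡φb = cong₂ _∨_ (eqFin-false (difference≢ flips-k a b φa≡φb))
                                   (eqFin-false (difference≢ flips-l a b φa≡φb))

-- Saturated sets

module _ {n : ℕ} where

  ⊆-trans : {U V W : Subset n} → U ⊆ V → V ⊆ W → U ⊆ W
  ⊆-trans U⊆V V⊆W x x∈U = V⊆W x (U⊆V x x∈U)

  ≐⇒⊆ : {U V : Subset n} → U ≐ V → U ⊆ V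
  ≐⇒⊆ U≐V x x∈U = trans (sym (U≐V x)) x∈U

  ≐-sym : {U V : Subset n} → U ≐ V → V ≐ U
  ≐-sym U≐V x = sym (U≐V x)

  ⊆-antisym : {U V : Subset n} → U ⊆ V → V ⊆ U → U ≐ V
  ⊆-antisym {U} {V} U⊆V V⊆U x with U x in Ux | V x in Vx
  ... | true | true = refl
  ... | false | false = refl
  ... | true | false = case trans (sym (U⊆V x Ux)) Vx of λ ()
  ... | false | true = case trans (sym (V⊆U x Vx)) Ux of λ ()

  ⊆-absurd : ∀ {A : Set} {U V : Subset n} x → U x ≡ true → V x ≡ false → U ⊆ V → A
  ⊆-absurd x x∈U x∉V U⊆V = case trans (sym (U⊆V x x∈U)) x∉V of λ ()

  avoidable-antitone : {U V : Subset n} → U ⊆ V → Avoidable V → Avoidable U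
  avoidable-antitone {U} {V} U⊆V (c , c-true , c-false , avoids) =
    c , c-true , c-false , λ x y x≢y cx≡cy → ∉U (avoids x y x≢y cx≡cy)
    where
    ∉U : ∀ {z} → V z ≡ false → U z ≡ false
    ∉U {z} z∉V with U z in z∈U
    ... | false = refl
    ... | true = case trans (sym (U⊆V z z∈U)) z∉V of λ ()

  module Saturation {I : Set} (L : I → Subset n)
                    (listed-avoidable : ∀ i → Avoidable (L i))
                    (avoidable⊆listed : ∀ U → Avoidable U → ∃ λ i → U ⊆ L i)
                    (listed-incomparable : ∀ i j → L i ⊆ L j → L j ⊆ L i) where

    saturated⇔listed : ∀ U → Saturated U ⇔ (∃ λ i → U ≐ L i)
    saturated⇔listed U = mk⇔ to from
      where
      to : Saturated U → ∃ λ i → U ≐ L i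
      to (U-avoidable , U-maximal) with avoidable⊆listed U U-avoidable
      ... | i , U⊆Lᵢ = i , ⊆-antisym U⊆Lᵢ (U-maximal (L i) (listed-avoidable i) U⊆Lᵢ)
      from : (∃ λ i → U ≐ L i) → Saturated U
      from (i , U≐Lᵢ) = avoidable-antitone (≐⇒⊆ U≐Lᵢ) (listed-avoidable i) , U-maximal
        where
        U-maximal : ∀ V → Avoidable V → U ⊆ V → V ⊆ U
        U-maximal V V-avoidable U⊆V with avoidable⊆listed V V-avoidable
        ... | j , V⊆Lⱼ = ⊆-trans V⊆Lⱼ (⊆-trans (listed-incomparable i j Lᵢ⊆Lⱼ) Lᵢ⊆U)
          where
          Lᵢ⊆U = ≐⇒⊆ (≐-sym U≐Lᵢ)
          Lᵢ⊆Lⱼ = ⊆-trans Lᵢ⊆U (⊆-trans U⊆V V⊆Lⱼ)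

module _ (k : ℕ) where

  private
    N = suc (suc (suc k))

  one : Fin N
  one = Fin.suc Fin.zero

  -- This is where n ≥ 3 is used: with a ≢ -a, the identity cannot join a reflection in U.
  one≢-one : one ≢ neg one
  one≢-one 1≡-1 = case ≡-mod⇒≡ {N} {2} {0} (s≤s (s≤s (s≤s z≤n))) (s≤s z≤n) 2≡0 of λ ()
    where
    2≡0 : + 2 ≡ + 0 mod N
    2≡0 = +-cong-mod (mod-trans (mod-reflexive (cong toℤ 1≡-1)) (⊖-mod Fin.zero one)) (mod-refl {a = + 1})

  avoidable⊆odd-set : ¬ 2 ∣ N → ∀ U → Avoidable U → ∃ λ i → U ⊆ odd-set i
  avoidable⊆odd-set N-odd U (c , _ , _ , avoids) = Classification.odd-classification one one≢-one U c avoids N-odd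

  odd-set-avoidable : ∀ i → Avoidable (odd-set {N} i)
  odd-set-avoidable identity = setE-avoidable one≢-one
  odd-set-avoidable reflections = reflections-only-avoidable {U = setF} (λ _ → refl)

  odd-sets-incomparable : ∀ i j → odd-set {N} i ⊆ odd-set j → odd-set j ⊆ odd-set {N} i
  odd-sets-incomparable identity identity _ _ x∈U = x∈U
  odd-sets-incomparable reflections reflections _ _ x∈U = x∈U
  odd-sets-incomparable identity reflections = ⊆-absurd (rot Fin.zero) refl refl
  odd-sets-incomparable reflections identity = ⊆-absurd (ref Fin.zero) refl refl

  listed-odd⇔ : ∀ {U : Subset N} → (∃ λ i → U ≐ odd-set i) ⇔ ListedOdd U
  listed-odd⇔ = mk⇔ (λ { (identity , U≐E) → inj₁ U≐E ; (reflections , U≐F) → inj₂ U≐F })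
                    (λ { (inj₁ U≐E) → identity , U≐E ; (inj₂ U≐F) → reflections , U≐F })

  divisor-order-odd : ∀ {T} → N ∣ T → ¬ 2 ∣ N div gcd N T
  divisor-order-odd {T} N∣T 2∣order = case ∣1⇒≡1 (subst (2 ∣_) order≡1 2∣order) of λ ()
    where
    order≡1 : N div gcd N T ≡ 1
    order≡1 = trans (cong (N div_) (GCD.unique (gcd-GCD N T) (GCD.is (∣-refl , N∣T) proj₁))) (n/n≡1 N)

  identity-and-nonzero : ∀ {k : Fin N} → 2 ∣ N div gcd N (toℕ k) → k ≢ Fin.zero
  identity-and-nonzero k-order refl = divisor-order-odd (N ∣0) k-order

  dbl-nonzero : ∀ {k : Fin N} → 2 ∣ N div gcd N (2 ℕ.* toℕ k) → dbl k ≢ Fin.zero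
  dbl-nonzero {k} k-order 2k≡0 =
    divisor-order-odd (≡0-mod⇒∣ (mod-trans (mod-sym (dbl-mod k)) (mod-reflexive (cong toℤ 2k≡0)))) k-order

  ∈setEk⇒ : ∀ {k x : Fin N} → setEk k (rot x) ≡ true → x ≢ Fin.zero → x ≡ k
  ∈setEk⇒ {k} {Fin.zero} _ x≢0 = ⊥-elim (x≢0 refl)
  ∈setEk⇒ {k} {Fin.suc x} x≡k _ = eqFin-true x≡k

  ∈setPair⇒ : ∀ {p q x : Fin N} → setPair p q (rot x) ≡ true → x ≡ p ⊎ x ≡ q
  ∈setPair⇒ {p} {q} {x} x∈pq with eqFin x p in x≡p
  ... | true = inj₁ (eqFin-true x≡p)
  ... | false = inj₂ (eqFin-true x∈pq)

  module _ (2∣N : 2 ∣ N) where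

    dbl-even : ∀ (k : Fin N) → isEven (toℕ (dbl k)) ≡ true
    dbl-even k = trans (isEven-⊕ 2∣N k k) (does-≟-≡ {isEven (toℕ k)} refl)

    pair⊆pair : ∀ {k l k' l' : Fin N} → dbl k ≢ dbl l → setPair (dbl k) (dbl l) ⊆ setPair (dbl k') (dbl l') →
                setPair (dbl k') (dbl l') ⊆ setPair (dbl k) (dbl l)
    pair⊆pair {k} {l} {k'} {l'} 2k≢2l pair⊆pair' (rot x) x∈pair' with ∈setPair⇒ {dbl k'} {dbl l'} {x} x∈pair'
      | ∈setPair⇒ {dbl k'} {dbl l'} (pair⊆pair' (rot (dbl k)) (∈setPair-left (dbl k) (dbl l)))
      | ∈setPair⇒ {dbl k'} {dbl l'} (pair⊆pair' (rot (dbl l)) (∈setPair-right (dbl k) (dbl l)))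
    ... | _ | inj₁ 2k≡2k' | inj₁ 2l≡2k' = ⊥-elim (2k≢2l (trans 2k≡2k' (sym 2l≡2k')))
    ... | _ | inj₂ 2k≡2l' | inj₂ 2l≡2l' = ⊥-elim (2k≢2l (trans 2k≡2l' (sym 2l≡2l')))
    ... | inj₁ refl | inj₁ 2k≡2k' | inj₂ _ = rot∈-resp (setPair (dbl k) (dbl l)) 2k≡2k' (∈setPair-left (dbl k) (dbl l))
    ... | inj₂ refl | inj₁ _ | inj₂ 2l≡2l' = rot∈-resp (setPair (dbl k) (dbl l)) 2l≡2l' (∈setPair-right (dbl k) (dbl l))
    ... | inj₁ refl | inj₂ _ | inj₁ 2l≡2k' = rot∈-resp (setPair (dbl k) (dbl l)) 2l≡2k' (∈setPair-right (dbl k) (dbl l))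
    ... | inj₂ refl | inj₂ 2k≡2l' | inj₁ _ = rot∈-resp (setPair (dbl k) (dbl l)) 2k≡2l' (∈setPair-left (dbl k) (dbl l))
    pair⊆pair _ _ (ref _) ()

    even-sets-incomparable : ∀ i j → even-set {N} i ⊆ even-set j → even-set j ⊆ even-set {N} i
    even-sets-incomparable (identity-and k k-order) (identity-and k' _) Ek⊆Ek' x =
      subst (λ z → setEk k' x ≡ true → setEk z x ≡ true) (sym k≡k') id
      where k≡k' = ∈setEk⇒ (Ek⊆Ek' (rot k) (∈setEk-k k)) (identity-and-nonzero k-order)
    even-sets-incomparable (identity-and k _) (rotation-pair k' l' k'-order l'-order _ _) Ek⊆pair
      with ∈setPair⇒ {dbl k'} {dbl l'} (Ek⊆pair (rot Fin.zero) refl)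
    ... | inj₁ 0≡2k' = ⊥-elim (dbl-nonzero {k'} k'-order (sym 0≡2k'))
    ... | inj₂ 0≡2l' = ⊥-elim (dbl-nonzero {l'} l'-order (sym 0≡2l'))
    even-sets-incomparable (identity-and k _) A∪B = ⊆-absurd (rot Fin.zero) refl refl
    even-sets-incomparable (identity-and k _) A∪C = ⊆-absurd (rot Fin.zero) refl refl
    even-sets-incomparable (identity-and k _) B∪C = ⊆-absurd (rot Fin.zero) refl refl
    even-sets-incomparable (rotation-pair k l k-order l-order _ 2k≢2l) (identity-and k' _) pair⊆Ek' =
      ⊥-elim (2k≢2l (trans (∈setEk⇒ (pair⊆Ek' (rot (dbl k)) (∈setPair-left (dbl k) (dbl l))) (dbl-nonzero {k} k-order))
                           (sym (∈setEk⇒ (pair⊆Ek' (rot (dbl l)) (∈setPair-right (dbl k) (dbl l))) (dbl-nonzero {l} l-order)))))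
    even-sets-incomparable (rotation-pair k l _ _ _ 2k≢2l) (rotation-pair k' l' _ _ _ _) = pair⊆pair {k} {l} {k'} {l'} 2k≢2l
    even-sets-incomparable (rotation-pair k l _ _ _ _) A∪B =
      ⊆-absurd (rot (dbl k)) (∈setPair-left (dbl k) (dbl l)) (cong (λ b → not b ∨ false) (dbl-even k))
    even-sets-incomparable (rotation-pair k l _ _ _ _) A∪C =
      ⊆-absurd (rot (dbl k)) (∈setPair-left (dbl k) (dbl l)) (cong (λ b → not b ∨ false) (dbl-even k))
    even-sets-incomparable (rotation-pair k l _ _ _ _) B∪C = ⊆-absurd (rot (dbl k)) (∈setPair-left (dbl k) (dbl l)) refl
    even-sets-incomparable A∪B (identity-and _ _) = ⊆-absurd (ref Fin.zero) refl refl
    even-sets-incomparable A∪B (rotation-pair _ _ _ _ _ _) = ⊆-absurd (ref Fin.zero) refl refl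
    even-sets-incomparable A∪B A∪B _ _ x∈U = x∈U
    even-sets-incomparable A∪B A∪C = ⊆-absurd (ref Fin.zero) refl refl
    even-sets-incomparable A∪B B∪C = ⊆-absurd (rot one) refl refl
    even-sets-incomparable A∪C (identity-and _ _) = ⊆-absurd (ref one) refl refl
    even-sets-incomparable A∪C (rotation-pair _ _ _ _ _ _) = ⊆-absurd (ref one) refl refl
    even-sets-incomparable A∪C A∪B = ⊆-absurd (ref one) refl refl
    even-sets-incomparable A∪C A∪C _ _ x∈U = x∈U
    even-sets-incomparable A∪C B∪C = ⊆-absurd (rot one) refl refl
    even-sets-incomparable B∪C (identity-and _ _) = ⊆-absurd (ref one) refl refl
    even-sets-incomparable B∪C (rotation-pair _ _ _ _ _ _) = ⊆-absurd (ref one) refl refl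
    even-sets-incomparable B∪C A∪B = ⊆-absurd (ref one) refl refl
    even-sets-incomparable B∪C A∪C = ⊆-absurd (ref Fin.zero) refl refl
    even-sets-incomparable B∪C B∪C _ _ x∈U = x∈U

    avoidable⊆even-set : ∀ U → Avoidable U → ∃ λ i → U ⊆ even-set i
    avoidable⊆even-set U (c , _ , _ , avoids) = Classification.even-classification one one≢-one U c avoids 2∣N

    even-set-avoidable : ∀ i → Avoidable (even-set {N} i)
    even-set-avoidable (identity-and k k-order) = setEk-avoidable k k-order
    even-set-avoidable (rotation-pair k l k-order _ same-2-valuation _) = setPair-avoidable k l k-order same-2-valuation
    even-set-avoidable A∪B = A∪B-avoidable 2∣N
    even-set-avoidable A∪C = A∪C-avoidable 2∣N {one} refl
    even-set-avoidable B∪C = reflections-only-avoidable {U = setB ∪ setC} (λ _ → refl)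

  listed-even⇔ : ∀ {U : Subset N} → (∃ λ i → U ≐ even-set i) ⇔ ListedEven N U
  listed-even⇔ = mk⇔
    (λ { (identity-and k k-order , U≐) → inj₁ (k , k-order , U≐)
       ; (rotation-pair k l k-order l-order v 2k≢2l , U≐) → inj₂ (inj₁ (k , l , k-order , l-order , v , 2k≢2l , U≐))
       ; (A∪B , U≐) → inj₂ (inj₂ (inj₁ U≐))
       ; (A∪C , U≐) → inj₂ (inj₂ (inj₂ (inj₁ U≐)))
       ; (B∪C , U≐) → inj₂ (inj₂ (inj₂ (inj₂ U≐))) })
    (λ { (inj₁ (k , k-order , U≐)) → identity-and k k-order , U≐
       ; (inj₂ (inj₁ (k , l , k-order , l-order , v , 2k≢2l , U≐))) → rotation-pair k l k-order l-order v 2k≢2l , U≐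
       ; (inj₂ (inj₂ (inj₁ U≐))) → A∪B , U≐
       ; (inj₂ (inj₂ (inj₂ (inj₁ U≐)))) → A∪C , U≐
       ; (inj₂ (inj₂ (inj₂ (inj₂ U≐)))) → B∪C , U≐ })

theorem4p7 : (n : ℕ) → 3 ≤ n → (U : Subset n) →
    ((¬ (2 ∣ n)) → (Saturated U ⇔ ListedOdd U))
    × (2 ∣ n → (Saturated U ⇔ ListedEven n U))
theorem4p7 (suc (suc (suc k))) _ U =
  (λ N-odd → listed-odd⇔ k ⇔-∘ Saturation.saturated⇔listed odd-set (odd-set-avoidable k)
                                  (avoidable⊆odd-set k N-odd) (odd-sets-incomparable k) U) ,
  (λ 2∣N → listed-even⇔ k ⇔-∘ Saturation.saturated⇔listed even-set (even-set-avoidable k 2∣N)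
                                 (avoidable⊆even-set k 2∣N) (even-sets-incomparable k 2∣N) U)
theorem4p7 (suc (suc zero)) (s≤s (s≤s ()))
theorem4p7 (suc zero) (s≤s ())
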